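{- Let $k\geqslant1$, $a_0,\ldots,a_k\in\mathbb Z$, $n_0,\ldots,n_k\in\mathbb Z^+$, $m_1,\ldots,m_k\in\mathbb Z^+$, and $m=\lfloor\sum_{s=1}^km_s/n_s\rfloor$. Suppose that every $x\in\mathbb Z$ satisfies $|\{0\leqslant s\leqslant k: x\equiv a_s\pmod{n_s}\}|>m$. Suppose further that $J\subseteq[1,k]$ is such that there is no $I\subseteq[1,k]$ with $I\neq J$ and $\sum_{s\in I}m_s/n_s=\sum_{s\in J}m_s/n_s$. Let $\bar J=[1,k]\setminus J$. Then $$\Big\{n_0\sum_{s\in J}\frac{m_s}{n_s}\Big\}+\Big\{n_0\sum_{s\in\bar J}\frac{m_s}{n_s}\Big\}<1,$$ and moreover $\sum_{s\in J}m_s/n_s\geqslant m$ or $\sum_{s\in\bar J}m_s/n_s\geqslant m$.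
   Context: $[1,k]=\{1,\ldots,k\}$; $\{\alpha\}$ denotes the fractional part of a real number $\alpha$ and $\lfloor\alpha\rfloor$ its integer part. Empty sums are $0$. -}

module Defs where

open import Data.Nat as ℕ using (ℕ; zero; suc; _<_)
open import Data.Nat.Base using (>-nonZero)
open import Data.Integer as ℤ using (ℤ; +_)
open import Data.Integer.Divisibility.Signed using (_∣?_)
open import Data.Fin as Fin using (Fin)
open import Data.Fin.Subset using (Subset; inside; outside)
open import Data.Vec using ([]; _∷_)
open import Data.List using (length; filter)
open import Data.List.Base using (allFin)
open import Data.Rational as ℚ using (ℚ; 0ℚ; floor)

ratio : (m n : ℕ) → 0 < n → ℚ
ratio m n p = (+ m) ℚ./ n
  where instance _ = >-nonZero p

sumOver : {k : ℕ} → Subset k → (Fin k → ℚ) → ℚ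
sumOver []             f = 0ℚ
sumOver (inside  ∷ J) f = f Fin.zero ℚ.+ sumOver J (λ i → f (Fin.suc i))
sumOver (outside ∷ J) f = sumOver J (λ i → f (Fin.suc i))

frac : ℚ → ℚ
frac p = p ℚ.- (floor p ℚ./ 1)

coverCount : {K : ℕ} → (Fin K → ℤ) → (Fin K → ℕ) → ℤ → ℕ
coverCount {K} a n x = length (filter (λ s → (+ n s) ∣? (x ℤ.- a s)) (allFin K))

{-# OPTIONS --safe #-}
module Submission where

-- Write mₛ / nₛ = eₛ / L with L = n₀ L′, L′ = ∏ nₛ, and for I ⊆ [1,k] let E I = Σ_{s∈I} eₛ,
-- B I = Σ_{s∈I} aₛ eₛ. Roots of unity are replaced by the integer-valued L-periodic weight
-- `sieve` = ∏_{p ∣ L prime} (1 - shift by L/p) applied to [L ∣ ·]: its sums over x mod L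
-- along c + x d vanish unless L ∣ d, and sieve 0 = 1. Every x makes at least m of the
-- (x - aₛ) eₛ divisible by L (more than m if n₀ ∤ x - a₀), so by finite differences
-- Σ_I (-1)^|I| sieve (c - Σ_{s∈I} (x - aₛ) eₛ) (E I)^j = 0 for j < m. Averaging over x gives
-- vanishing power sums Σ_i wᵢ (ρ + i L)^j, j < m, over the m + 1 nodes ρ + i L, and
-- Vandermonde turns the m-th one into any single weight times ± Lᵐ i! (m - i)!. For J with a
-- unique E J that weight is ±1, forcing E J / L ∈ {0, m}; and since the m-th sum is invariant
-- under (ρ, g) ↦ (ρ + L′, g + a₀ L′), the top node (E J mod L′) + (n₀ - 1) L′ + m L also carries
-- a nonzero weight, so it is at most E ⊤. The first fact gives m L ≤ E J or m L ≤ E ⊤ - E J;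
-- the second gives E J mod L′ ≤ E ⊤ mod L′, so the two fractional parts add up to
-- (E ⊤ mod L′) / L′ < 1.

open import Defs
open import Data.Nat as ℕ using (ℕ; suc; _<_; _≤_)
open import Data.Integer as ℤ using (ℤ; +_)
open import Data.Fin using (Fin; zero; suc)
open import Data.Fin.Subset using (Subset; ∁; ⊤)
open import Data.Rational as ℚ using (ℚ; floor)
open import Data.Product using (_×_)
open import Data.Sum using (_⊎_)
open import Relation.Binary.PropositionalEquality using (_≡_)

open import Data.Nat using (zero; NonZero; z≤n; s≤s)
import Data.Nat.Properties as ℕP
open import Data.Nat.DivMod as ℕDM using (_%_)
import Data.Nat.Divisibility as ℕ∣
open import Data.Nat.Combinatorics using (k![n∸k]!∣n!)
open import Data.Nat.GCD using (module Bézout; GCD; gcd; gcd[m,n]≢0)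
open import Data.Nat.ListAction using (sum; product)
open import Data.Nat.ListAction.Properties using (∈⇒∣product; product≢0)
open import Data.Nat.Primality using (Prime; prime?)
open import Data.Nat.Primality.Factorisation using (factorise; PrimeFactorisation; factorisationHasAllPrimeFactors)
import Data.Nat.Tactic.RingSolver as ℕRing
open import Data.Integer using (0ℤ; 1ℤ; _+_; _*_; -_; _-_; _^_)
import Data.Integer.Properties as ℤP
import Data.Integer.DivMod as ℤDM
open import Data.Integer.Divisibility.Signed as ℤ∣ using (_∣_; _∣?_; divides)
open import Data.Integer.Solver using (module +-*-Solver)
open import Data.Rational using (↥_; ↧_; ↧ₙ_)
import Data.Rational.Properties as ℚP
open import Data.Rational.Unnormalised as ℚᵘ using (mkℚᵘ)
import Data.Rational.Unnormalised.Properties as ℚᵘP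
open import Data.Fin.Subset using (inside; outside)
open import Data.Vec using ([]; _∷_)
import Data.Vec.Properties as VecP
open import Data.List as List using (List; []; _∷_; _++_; length; filter; tabulate)
import Data.List.Properties as ListP
import Data.List.Membership.Propositional as List
open import Data.List.Membership.Propositional.Properties using (∈-filter⁺; ∈-filter⁻; ∈-upTo⁺; ∈-map⁺; ∈-tabulate⁺)
import Data.List.Relation.Unary.Any as Any
open import Data.List.Relation.Unary.All as All using (All)
import Data.List.Relation.Unary.All.Properties as AllP
import Data.List.Relation.Unary.AllPairs as AllPairs
open import Data.List.Relation.Unary.Unique.Propositional as Unique using (Unique)
import Data.List.Relation.Unary.Unique.Propositional.Properties as UniqueP
open import Data.List.Relation.Binary.Permutation.Propositional using (_↭_; ↭-sym; ↭⇒↭ₛ)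
open import Data.List.Relation.Binary.Permutation.Propositional.Properties using (shift; All-resp-↭)
open import Data.Product using (∃-syntax; _,_; proj₁; proj₂)
open import Data.Sum as Sum using (inj₁; inj₂)
open import Data.Empty using (⊥-elim)
open import Function using (_∘_)
open import Relation.Binary.PropositionalEquality using (_≢_; refl; sym; trans; cong; cong₂; subst; subst₂; setoid; module ≡-Reasoning)
open import Data.List.Relation.Binary.Permutation.Setoid.Properties (setoid ℕ) using (Unique-resp-↭)
open import Relation.Nullary using (Dec; yes; no; ¬_)
open import Relation.Nullary.Decidable using (_×-dec_)
open import Relation.Unary using (Decidable)

open +-*-Solver
import Algebra.Properties.AbelianGroup ℤP.+-0-abelianGroup as ℤ+

-- Alternating sums over subsets

altSum : ∀ {k} → (Subset k → ℤ) → ℤ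
altSum {zero} f = f []
altSum {suc k} f = altSum (λ I → f (outside ∷ I)) - altSum (λ I → f (inside ∷ I))

altSum-cong : ∀ {k} {f g : Subset k → ℤ} → (∀ I → f I ≡ g I) → altSum f ≡ altSum g
altSum-cong {zero} f≡g = f≡g []
altSum-cong {suc k} f≡g = cong₂ _-_ (altSum-cong (f≡g ∘ (outside ∷_))) (altSum-cong (f≡g ∘ (inside ∷_)))

altSum-zero : ∀ {k} {f : Subset k → ℤ} → (∀ I → f I ≡ 0ℤ) → altSum f ≡ 0ℤ
altSum-zero {zero} f≡0 = f≡0 []
altSum-zero {suc k} f≡0 = cong₂ _-_ (altSum-zero (f≡0 ∘ (outside ∷_))) (altSum-zero (f≡0 ∘ (inside ∷_)))

altSum-+ : ∀ {k} (f g : Subset k → ℤ) → altSum (λ I → f I + g I) ≡ altSum f + altSum g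
altSum-+ {zero} f g = refl
altSum-+ {suc k} f g = begin
    altSum (λ I → f (outside ∷ I) + g (outside ∷ I)) - altSum (λ I → f (inside ∷ I) + g (inside ∷ I))
      ≡⟨ cong₂ _-_ (altSum-+ (f ∘ (outside ∷_)) (g ∘ (outside ∷_))) (altSum-+ (f ∘ (inside ∷_)) (g ∘ (inside ∷_))) ⟩
    (fo + go) - (fi + gi)
      ≡⟨ solve 4 (λ a b c d → (a :+ b) :- (c :+ d) := (a :- c) :+ (b :- d)) refl fo go fi gi ⟩
    (fo - fi) + (go - gi) ∎
  where
  open ≡-Reasoning
  fo = altSum (λ I → f (outside ∷ I)); fi = altSum (λ I → f (inside ∷ I))
  go = altSum (λ I → g (outside ∷ I)); gi = altSum (λ I → g (inside ∷ I))

altSum-*ˡ : ∀ {k} (c : ℤ) (f : Subset k → ℤ) → altSum (λ I → c * f I) ≡ c * altSum f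
altSum-*ˡ {zero} c f = refl
altSum-*ˡ {suc k} c f = trans (cong₂ _-_ (altSum-*ˡ c (f ∘ (outside ∷_))) (altSum-*ˡ c (f ∘ (inside ∷_))))
  (solve 3 (λ c a b → c :* a :- c :* b := c :* (a :- b)) refl c (altSum (λ I → f (outside ∷ I))) (altSum (λ I → f (inside ∷ I))))

altSum-*ʳ : ∀ {k} (f : Subset k → ℤ) (c : ℤ) → altSum (λ I → f I * c) ≡ altSum f * c
altSum-*ʳ f c = trans (altSum-cong (λ I → ℤP.*-comm (f I) c)) (trans (altSum-*ˡ c f) (ℤP.*-comm c (altSum f)))

altSum-- : ∀ {k} (f g : Subset k → ℤ) → altSum (λ I → f I - g I) ≡ altSum f - altSum g
altSum-- f g = begin
    altSum (λ I → f I - g I)            ≡⟨ altSum-+ f (λ I → - g I) ⟩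
    altSum f + altSum (λ I → - g I)     ≡⟨ cong (_+_ (altSum f)) (altSum-cong (λ I → sym (ℤP.-1*i≡-i (g I)))) ⟩
    altSum f + altSum (λ I → - 1ℤ * g I) ≡⟨ cong (_+_ (altSum f)) (trans (altSum-*ˡ (- 1ℤ) g) (ℤP.-1*i≡-i (altSum g))) ⟩
    altSum f - altSum g ∎
  where open ≡-Reasoning

∣altSum∣-single : ∀ {k} (J : Subset k) {f : Subset k → ℤ} → (∀ I → I ≢ J → f I ≡ 0ℤ) →
                  ℤ.∣ altSum f ∣ ≡ ℤ.∣ f J ∣
∣altSum∣-single [] f₀ = refl
∣altSum∣-single (outside ∷ J) {f} f₀ = begin
    ℤ.∣ altSum (λ I → f (outside ∷ I)) - altSum (λ I → f (inside ∷ I)) ∣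
      ≡⟨ cong (λ t → ℤ.∣ altSum (λ I → f (outside ∷ I)) - t ∣) (altSum-zero (λ I → f₀ (inside ∷ I) λ ())) ⟩
    ℤ.∣ altSum (λ I → f (outside ∷ I)) + 0ℤ ∣
      ≡⟨ cong ℤ.∣_∣ (ℤP.+-identityʳ (altSum (λ I → f (outside ∷ I)))) ⟩
    ℤ.∣ altSum (λ I → f (outside ∷ I)) ∣
      ≡⟨ ∣altSum∣-single J (λ I I≢J → f₀ (outside ∷ I) (I≢J ∘ VecP.∷-injectiveʳ)) ⟩
    ℤ.∣ f (outside ∷ J) ∣ ∎
  where open ≡-Reasoning
∣altSum∣-single (inside ∷ J) {f} f₀ = begin
    ℤ.∣ altSum (λ I → f (outside ∷ I)) - altSum (λ I → f (inside ∷ I)) ∣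
      ≡⟨ cong (λ t → ℤ.∣ t - altSum (λ I → f (inside ∷ I)) ∣) (altSum-zero (λ I → f₀ (outside ∷ I) λ ())) ⟩
    ℤ.∣ 0ℤ - altSum (λ I → f (inside ∷ I)) ∣
      ≡⟨ cong ℤ.∣_∣ (ℤP.+-identityˡ (- altSum (λ I → f (inside ∷ I)))) ⟩
    ℤ.∣ - altSum (λ I → f (inside ∷ I)) ∣
      ≡⟨ ℤP.∣-i∣≡∣i∣ (altSum (λ I → f (inside ∷ I))) ⟩
    ℤ.∣ altSum (λ I → f (inside ∷ I)) ∣
      ≡⟨ ∣altSum∣-single J (λ I I≢J → f₀ (inside ∷ I) (I≢J ∘ VecP.∷-injectiveʳ)) ⟩
    ℤ.∣ f (inside ∷ J) ∣ ∎
  where open ≡-Reasoning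

subsetSum : ∀ {k} → Subset k → (Fin k → ℤ) → ℤ
subsetSum [] v = 0ℤ
subsetSum (outside ∷ I) v = subsetSum I (v ∘ suc)
subsetSum (inside ∷ I) v = v zero + subsetSum I (v ∘ suc)

subsetSumℕ : ∀ {k} → Subset k → (Fin k → ℕ) → ℕ
subsetSumℕ [] v = 0
subsetSumℕ (outside ∷ I) v = subsetSumℕ I (v ∘ suc)
subsetSumℕ (inside ∷ I) v = v zero ℕ.+ subsetSumℕ I (v ∘ suc)

subsetSum-pos : ∀ {k} (I : Subset k) (v : Fin k → ℕ) → subsetSum I (+_ ∘ v) ≡ + subsetSumℕ I v
subsetSum-pos [] v = refl
subsetSum-pos (outside ∷ I) v = subsetSum-pos I (v ∘ suc)
subsetSum-pos (inside ∷ I) v =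
  trans (cong (_+_ (+ v zero)) (subsetSum-pos I (v ∘ suc))) (sym (ℤP.pos-+ (v zero) (subsetSumℕ I (v ∘ suc))))

subsetSum-affine : ∀ {k} (I : Subset k) (x : ℤ) (a b : Fin k → ℤ) →
                   subsetSum I (λ s → (x - a s) * b s) ≡ x * subsetSum I b - subsetSum I (λ s → a s * b s)
subsetSum-affine [] x a b = sym (trans (ℤP.+-identityʳ (x * 0ℤ)) (ℤP.*-zeroʳ x))
subsetSum-affine (outside ∷ I) x a b = subsetSum-affine I x (a ∘ suc) (b ∘ suc)
subsetSum-affine (inside ∷ I) x a b = trans (cong (_+_ ((x - a zero) * b zero)) (subsetSum-affine I x (a ∘ suc) (b ∘ suc)))
  (solve 5 (λ x a b S T → (x :- a) :* b :+ (x :* S :- T) := x :* (b :+ S) :- (a :* b :+ T)) refl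
     x (a zero) (b zero) (subsetSum I (b ∘ suc)) (subsetSum I (λ s → a (suc s) * b (suc s))))

subsetSumℕ-≤-⊤ : ∀ {k} (I : Subset k) (v : Fin k → ℕ) → subsetSumℕ I v ≤ subsetSumℕ ⊤ v
subsetSumℕ-≤-⊤ [] v = z≤n
subsetSumℕ-≤-⊤ (outside ∷ I) v = ℕP.≤-trans (subsetSumℕ-≤-⊤ I (v ∘ suc)) (ℕP.m≤n+m _ (v zero))
subsetSumℕ-≤-⊤ (inside ∷ I) v = ℕP.+-monoʳ-≤ (v zero) (subsetSumℕ-≤-⊤ I (v ∘ suc))

subsetSumℕ-∁ : ∀ {k} (J : Subset k) (v : Fin k → ℕ) → subsetSumℕ J v ℕ.+ subsetSumℕ (∁ J) v ≡ subsetSumℕ ⊤ v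
subsetSumℕ-∁ [] v = refl
subsetSumℕ-∁ (inside ∷ J) v =
  trans (ℕP.+-assoc (v zero) _ _) (cong (v zero ℕ.+_) (subsetSumℕ-∁ J (v ∘ suc)))
subsetSumℕ-∁ (outside ∷ J) v = begin
    subsetSumℕ J (v ∘ suc) ℕ.+ (v zero ℕ.+ subsetSumℕ (∁ J) (v ∘ suc))
      ≡⟨ ℕP.+-comm (subsetSumℕ J (v ∘ suc)) _ ⟩
    (v zero ℕ.+ subsetSumℕ (∁ J) (v ∘ suc)) ℕ.+ subsetSumℕ J (v ∘ suc)
      ≡⟨ ℕP.+-assoc (v zero) _ _ ⟩
    v zero ℕ.+ (subsetSumℕ (∁ J) (v ∘ suc) ℕ.+ subsetSumℕ J (v ∘ suc))
      ≡⟨ cong (v zero ℕ.+_) (trans (ℕP.+-comm (subsetSumℕ (∁ J) (v ∘ suc)) _) (subsetSumℕ-∁ J (v ∘ suc))) ⟩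
    v zero ℕ.+ subsetSumℕ ⊤ (v ∘ suc) ∎
  where open ≡-Reasoning

𝟙 : ∀ {p} {P : Set p} → Dec P → ℕ
𝟙 (yes _) = 1
𝟙 (no _) = 0

𝟙≤1 : ∀ {p} {P : Set p} (P? : Dec P) → 𝟙 P? ≤ 1
𝟙≤1 (yes _) = ℕP.≤-refl
𝟙≤1 (no _) = z≤n

𝟙-no : ∀ {p} {P : Set p} (P? : Dec P) → ¬ P → 𝟙 P? ≡ 0
𝟙-no (yes p) ¬p = ⊥-elim (¬p p)
𝟙-no (no _) ¬p = refl

𝟙-yes : ∀ {p} {P : Set p} (P? : Dec P) → P → 𝟙 P? ≡ 1
𝟙-yes (yes _) p = refl
𝟙-yes (no ¬p) p = ⊥-elim (¬p p)

count : ∀ {k p} {P : Fin k → Set p} → Decidable P → ℕ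
count {zero} P? = 0
count {suc k} P? = 𝟙 (P? zero) ℕ.+ count (P? ∘ suc)

count-mono : ∀ {k p q} {P : Fin k → Set p} {Q : Fin k → Set q} (P? : Decidable P) (Q? : Decidable Q) →
             (∀ s → P s → Q s) → count P? ≤ count Q?
count-mono {zero} P? Q? P⇒Q = z≤n
count-mono {suc k} P? Q? P⇒Q with P? zero | Q? zero
... | yes _ | yes _ = s≤s (count-mono (P? ∘ suc) (Q? ∘ suc) (P⇒Q ∘ suc))
... | yes p | no ¬q = ⊥-elim (¬q (P⇒Q zero p))
... | no _  | yes _ = ℕP.m≤n⇒m≤1+n (count-mono (P? ∘ suc) (Q? ∘ suc) (P⇒Q ∘ suc))
... | no _  | no _  = count-mono (P? ∘ suc) (Q? ∘ suc) (P⇒Q ∘ suc)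

length-filter-tabulate : ∀ {k p} {A : Set} {P : A → Set p} (P? : Decidable P) (g : Fin k → A) →
                         length (filter P? (tabulate g)) ≡ count (P? ∘ g)
length-filter-tabulate {zero} P? g = refl
length-filter-tabulate {suc k} P? g with P? (g zero)
... | yes _ = cong suc (length-filter-tabulate P? (g ∘ suc))
... | no _ = length-filter-tabulate P? (g ∘ suc)

DegreeBelow : ℕ → (ℤ → ℤ) → Set
DegreeBelow zero f = ∀ X → f X ≡ 0ℤ
DegreeBelow (suc d) f = ∀ c → DegreeBelow d (λ X → f (X + c) - f X)

Periodic : ℕ → (ℤ → ℤ) → Set
Periodic L F = ∀ z t → (+ L) ∣ t → F (z + t) ≡ F z

-- Each s with L ∣ φ s pairs I with I ∪ {s}: F does not see the difference, so f is
-- replaced by its finite difference in the direction e s, which has smaller degree.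
altSum-vanishes : ∀ L {k} (e φ : Fin k → ℤ) {F : ℤ → ℤ} → Periodic L F →
                  {f : ℤ → ℤ} → DegreeBelow (count (λ s → (+ L) ∣? φ s)) f → ∀ z A →
                  altSum (λ I → F (z + subsetSum I φ) * f (A + subsetSum I e)) ≡ 0ℤ
altSum-vanishes L {zero} e φ {F} per deg z A = trans (cong (F (z + 0ℤ) *_) (deg (A + 0ℤ))) (ℤP.*-zeroʳ (F (z + 0ℤ)))
altSum-vanishes L {suc k} e φ {F} per {f} deg z A with (+ L) ∣? φ zero
... | yes L∣φ₀ = begin
    altSum (λ I → F (z + Φ I) * f (A + E I)) - altSum (λ I → F (z + (φ zero + Φ I)) * f (A + (e zero + E I)))
      ≡⟨ sym (altSum-- (λ I → F (z + Φ I) * f (A + E I)) (λ I → F (z + (φ zero + Φ I)) * f (A + (e zero + E I)))) ⟩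
    altSum (λ I → F (z + Φ I) * f (A + E I) - F (z + (φ zero + Φ I)) * f (A + (e zero + E I)))
      ≡⟨ altSum-cong pair ⟩
    altSum (λ I → - (F (z + Φ I) * Δf (A + E I)))
      ≡⟨ altSum-cong (λ I → sym (ℤP.-1*i≡-i (F (z + Φ I) * Δf (A + E I)))) ⟩
    altSum (λ I → - 1ℤ * (F (z + Φ I) * Δf (A + E I)))
      ≡⟨ altSum-*ˡ (- 1ℤ) (λ I → F (z + Φ I) * Δf (A + E I)) ⟩
    - 1ℤ * altSum (λ I → F (z + Φ I) * Δf (A + E I))
      ≡⟨ cong (- 1ℤ *_) (altSum-vanishes L (e ∘ suc) (φ ∘ suc) per (deg (e zero)) z A) ⟩
    0ℤ ∎
  where
  open ≡-Reasoning
  Φ = λ I → subsetSum I (φ ∘ suc)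
  E = λ I → subsetSum I (e ∘ suc)
  Δf = λ X → f (X + e zero) - f X
  pair : ∀ I → F (z + Φ I) * f (A + E I) - F (z + (φ zero + Φ I)) * f (A + (e zero + E I))
             ≡ - (F (z + Φ I) * Δf (A + E I))
  pair I = begin
      F (z + Φ I) * f (A + E I) - F (z + (φ zero + Φ I)) * f (A + (e zero + E I))
        ≡⟨ cong₂ (λ u v → F (z + Φ I) * f (A + E I) - F u * f v)
             (solve 3 (λ a b c → a :+ (b :+ c) := (a :+ c) :+ b) refl z (φ zero) (Φ I))
             (solve 3 (λ a b c → a :+ (b :+ c) := (a :+ c) :+ b) refl A (e zero) (E I)) ⟩
      F (z + Φ I) * f (A + E I) - F ((z + Φ I) + φ zero) * f ((A + E I) + e zero)
        ≡⟨ cong (λ u → F (z + Φ I) * f (A + E I) - u * f ((A + E I) + e zero)) (per (z + Φ I) (φ zero) L∣φ₀) ⟩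
      F (z + Φ I) * f (A + E I) - F (z + Φ I) * f ((A + E I) + e zero)
        ≡⟨ solve 3 (λ a b c → a :* b :- a :* c := :- (a :* (c :- b))) refl (F (z + Φ I)) (f (A + E I)) (f ((A + E I) + e zero)) ⟩
      - (F (z + Φ I) * Δf (A + E I)) ∎
... | no _ = begin
    altSum (λ I → F (z + Φ I) * f (A + E I)) - altSum (λ I → F (z + (φ zero + Φ I)) * f (A + (e zero + E I)))
      ≡⟨ cong₂ _-_ (altSum-vanishes L (e ∘ suc) (φ ∘ suc) per deg z A)
           (trans (altSum-cong (λ I → cong₂ (λ u v → F u * f v) (sym (ℤP.+-assoc z (φ zero) (Φ I))) (sym (ℤP.+-assoc A (e zero) (E I)))))
                  (altSum-vanishes L (e ∘ suc) (φ ∘ suc) per deg (z + φ zero) (A + e zero))) ⟩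
    0ℤ - 0ℤ ∎
  where
  open ≡-Reasoning
  Φ = λ I → subsetSum I (φ ∘ suc)
  E = λ I → subsetSum I (e ∘ suc)

DegreeBelow-cong : ∀ d {f g : ℤ → ℤ} → (∀ X → f X ≡ g X) → DegreeBelow d f → DegreeBelow d g
DegreeBelow-cong zero f≡g deg X = trans (sym (f≡g X)) (deg X)
DegreeBelow-cong (suc d) f≡g deg c = DegreeBelow-cong d (λ X → cong₂ _-_ (f≡g (X + c)) (f≡g X)) (deg c)

DegreeBelow-suc : ∀ d {f} → DegreeBelow d f → DegreeBelow (suc d) f
DegreeBelow-suc zero deg c X = cong₂ _-_ (deg (X + c)) (deg X)
DegreeBelow-suc (suc d) deg c = DegreeBelow-suc d (deg c)

DegreeBelow-mono : ∀ {d d′ f} → d ≤ d′ → DegreeBelow d f → DegreeBelow d′ f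
DegreeBelow-mono {d′ = zero} z≤n deg = deg
DegreeBelow-mono {d′ = suc d′} z≤n deg = DegreeBelow-suc d′ (DegreeBelow-mono z≤n deg)
DegreeBelow-mono (s≤s d≤d′) deg c = DegreeBelow-mono d≤d′ (deg c)

DegreeBelow-+ : ∀ d {f g} → DegreeBelow d f → DegreeBelow d g → DegreeBelow d (λ X → f X + g X)
DegreeBelow-+ zero degf degg X = cong₂ _+_ (degf X) (degg X)
DegreeBelow-+ (suc d) {f} {g} degf degg c =
  DegreeBelow-cong d (λ X → solve 4 (λ a b u v → (a :- u) :+ (b :- v) := (a :+ b) :- (u :+ v)) refl (f (X + c)) (g (X + c)) (f X) (g X))
    (DegreeBelow-+ d (degf c) (degg c))

DegreeBelow-*ˡ : ∀ d a {f} → DegreeBelow d f → DegreeBelow d (λ X → a * f X)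
DegreeBelow-*ˡ zero a deg X = trans (cong (a *_) (deg X)) (ℤP.*-zeroʳ a)
DegreeBelow-*ˡ (suc d) a {f} deg c =
  DegreeBelow-cong d (λ X → solve 3 (λ a u v → a :* (u :- v) := a :* u :- a :* v) refl a (f (X + c)) (f X))
    (DegreeBelow-*ˡ d a (deg c))

DegreeBelow-shift : ∀ d a {f} → DegreeBelow d f → DegreeBelow d (λ X → f (X + a))
DegreeBelow-shift zero a deg X = deg (X + a)
DegreeBelow-shift (suc d) a {f} deg c =
  DegreeBelow-cong d (λ X → cong (λ u → f u - f (X + a)) (solve 3 (λ x a c → (x :+ a) :+ c := (x :+ c) :+ a) refl X a c))
    (DegreeBelow-shift d a (deg c))

DegreeBelow-*X : ∀ d {f} → DegreeBelow d f → DegreeBelow (suc d) (λ X → X * f X)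
DegreeBelow-*X zero {f} deg c X = trans (cong₂ (λ u v → (X + c) * u - X * v) (deg (X + c)) (deg X))
  (solve 2 (λ x c → (x :+ c) :* con 0ℤ :- x :* con 0ℤ := con 0ℤ) refl X c)
DegreeBelow-*X (suc d) {f} deg c =
  DegreeBelow-cong (suc d) (λ X → solve 4 (λ x c u v → x :* (u :- v) :+ c :* u := (x :+ c) :* u :- x :* v) refl X c (f (X + c)) (f X))
    (DegreeBelow-+ (suc d) {λ X → X * (f (X + c) - f X)} {λ X → c * f (X + c)}
      (DegreeBelow-*X d (deg c)) (DegreeBelow-*ˡ (suc d) c (DegreeBelow-shift (suc d) c {f} deg)))

DegreeBelow-^ : ∀ j → DegreeBelow (suc j) (_^ j)
DegreeBelow-^ zero c X = ℤP.+-inverseʳ 1ℤ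
DegreeBelow-^ (suc j) = DegreeBelow-*X (suc j) (DegreeBelow-^ j)

-- Sums over a period

sumBelow : ℕ → (ℤ → ℤ) → ℤ
sumBelow zero G = 0ℤ
sumBelow (suc n) G = sumBelow n G + G (+ n)

sumBelow-cong : ∀ n {F G : ℤ → ℤ} → (∀ x → F x ≡ G x) → sumBelow n F ≡ sumBelow n G
sumBelow-cong zero F≡G = refl
sumBelow-cong (suc n) F≡G = cong₂ _+_ (sumBelow-cong n F≡G) (F≡G _)

sumBelow-zero : ∀ n {F : ℤ → ℤ} → (∀ x → F x ≡ 0ℤ) → sumBelow n F ≡ 0ℤ
sumBelow-zero zero F≡0 = refl
sumBelow-zero (suc n) F≡0 = cong₂ _+_ (sumBelow-zero n F≡0) (F≡0 _)

sumBelow-- : ∀ n (F G : ℤ → ℤ) → sumBelow n (λ x → F x - G x) ≡ sumBelow n F - sumBelow n G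
sumBelow-- zero F G = refl
sumBelow-- (suc n) F G = trans (cong (_+ (F (+ n) - G (+ n))) (sumBelow-- n F G))
  (solve 4 (λ a b c d → (a :- b) :+ (c :- d) := (a :+ c) :- (b :+ d)) refl (sumBelow n F) (sumBelow n G) (F (+ n)) (G (+ n)))

sumBelow-*ʳ : ∀ n (F : ℤ → ℤ) c → sumBelow n (λ x → F x * c) ≡ sumBelow n F * c
sumBelow-*ʳ zero F c = sym (ℤP.*-zeroˡ c)
sumBelow-*ʳ (suc n) F c = trans (cong (_+ F (+ n) * c) (sumBelow-*ʳ n F c)) (sym (ℤP.*-distribʳ-+ c (sumBelow n F) (F (+ n))))

sumBelow-const : ∀ n c → sumBelow n (λ _ → c) ≡ + n * c
sumBelow-const zero c = sym (ℤP.*-zeroˡ c)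
sumBelow-const (suc n) c = begin
  sumBelow n (λ _ → c) + c ≡⟨ cong (_+ c) (sumBelow-const n c) ⟩
  + n * c + c             ≡⟨ solve 2 (λ n c → n :* c :+ c := (con 1ℤ :+ n) :* c) refl (+ n) c ⟩
  (1ℤ + + n) * c          ∎
  where open ≡-Reasoning

sumBelow-altSum : ∀ n {k} (h : ℤ → Subset k → ℤ) → sumBelow n (λ x → altSum (h x)) ≡ altSum (λ I → sumBelow n (λ x → h x I))
sumBelow-altSum zero {k} h = sym (altSum-zero {k} (λ I → refl))
sumBelow-altSum (suc n) h = trans (cong (_+ altSum (h (+ n))) (sumBelow-altSum n h))
  (sym (altSum-+ (λ I → sumBelow n (λ x → h x I)) (h (+ n))))

sumBelow-shift-1 : ∀ n (G : ℤ → ℤ) → sumBelow n (λ x → G (x + 1ℤ)) + G 0ℤ ≡ sumBelow n G + G (+ n)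
sumBelow-shift-1 zero G = refl
sumBelow-shift-1 (suc n) G = begin
    (sumBelow n (λ x → G (x + 1ℤ)) + G (+ n + 1ℤ)) + G 0ℤ
      ≡⟨ solve 3 (λ a b c → (a :+ b) :+ c := (a :+ c) :+ b) refl (sumBelow n (λ x → G (x + 1ℤ))) (G (+ n + 1ℤ)) (G 0ℤ) ⟩
    (sumBelow n (λ x → G (x + 1ℤ)) + G 0ℤ) + G (+ n + 1ℤ)
      ≡⟨ cong₂ _+_ (sumBelow-shift-1 n G) (cong G (ℤP.+-comm (+ n) 1ℤ)) ⟩
    (sumBelow n G + G (+ n)) + G (+ suc n) ∎
  where open ≡-Reasoning

module _ (L : ℕ) {G : ℤ → ℤ} (G-periodic : Periodic L G) where

  sumBelow-periodic-shiftℕ : ∀ t → sumBelow L (λ x → G (x + + t)) ≡ sumBelow L G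
  sumBelow-periodic-shiftℕ zero = sumBelow-cong L (λ x → cong G (ℤP.+-identityʳ x))
  sumBelow-periodic-shiftℕ (suc t) = begin
      sumBelow L (λ x → G (x + + suc t))
        ≡⟨ sumBelow-cong L (λ x → cong G (solve 2 (λ x t → x :+ (con 1ℤ :+ t) := (x :+ con 1ℤ) :+ t) refl x (+ t))) ⟩
      sumBelow L (λ x → Gₜ (x + 1ℤ))
        ≡⟨ ℤ+.∙-cancelʳ (Gₜ 0ℤ) _ _ (trans (sumBelow-shift-1 L Gₜ) (cong (_+_ (sumBelow L Gₜ)) Gₜ[L]≡Gₜ[0])) ⟩
      sumBelow L Gₜ
        ≡⟨ sumBelow-periodic-shiftℕ t ⟩
      sumBelow L G ∎
    where
    open ≡-Reasoning
    Gₜ = λ x → G (x + + t)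
    Gₜ[L]≡Gₜ[0] : Gₜ (+ L) ≡ Gₜ 0ℤ
    Gₜ[L]≡Gₜ[0] = trans (cong G (ℤP.+-comm (+ L) (+ t))) (trans (G-periodic (+ t) (+ L) (ℤ∣.∣-refl {+ L})) (cong G (sym (ℤP.+-identityˡ (+ t)))))

  sumBelow-periodic-shift : .{{_ : NonZero L}} → ∀ y → sumBelow L (λ x → G (x + y)) ≡ sumBelow L G
  sumBelow-periodic-shift y = trans (sumBelow-cong L reduce) (sumBelow-periodic-shiftℕ (y ℤ.%ℕ L))
    where
    reduce : ∀ x → G (x + y) ≡ G (x + + (y ℤ.%ℕ L))
    reduce x = trans (cong (λ u → G (x + u)) (ℤDM.a≡a%ℕn+[a/ℕn]*n y L))
      (trans (cong G (sym (ℤP.+-assoc x (+ (y ℤ.%ℕ L)) ((y ℤ./ℕ L) * + L))))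
        (G-periodic (x + + (y ℤ.%ℕ L)) ((y ℤ./ℕ L) * + L) (divides (y ℤ./ℕ L) refl)))

-- An integer substitute for additive characters modulo L

module Sieve (L : ℕ) {{L≢0 : NonZero L}} where

  ind : ℤ → ℤ
  ind h = + 𝟙 ((+ L) ∣? h)

  ind-periodic : Periodic L ind
  ind-periodic z t L∣t with (+ L) ∣? (z + t) | (+ L) ∣? z
  ... | yes _ | yes _ = refl
  ... | no _  | no _  = refl
  ... | yes L∣z+t | no L∤z = ⊥-elim (L∤z (ℤ∣.∣m+n∣n⇒∣m L∣z+t L∣t))
  ... | no L∤z+t | yes L∣z = ⊥-elim (L∤z+t (ℤ∣.∣m∣n⇒∣m+n L∣z L∣t))

  ind-yes : ∀ {h} → (+ L) ∣ h → ind h ≡ 1ℤ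
  ind-yes {h} L∣h = cong +_ (𝟙-yes ((+ L) ∣? h) L∣h)

  ind-no : ∀ {h} → ¬ (+ L) ∣ h → ind h ≡ 0ℤ
  ind-no {h} L∤h = cong +_ (𝟙-no ((+ L) ∣? h) L∤h)

  Δind : List ℕ → ℤ → ℤ
  Δind [] h = ind h
  Δind (q ∷ Q) h = Δind Q h - Δind Q (h - + q)

  Δind-periodic : ∀ Q → Periodic L (Δind Q)
  Δind-periodic [] = ind-periodic
  Δind-periodic (q ∷ Q) z t L∣t = cong₂ _-_ (Δind-periodic Q z t L∣t)
    (trans (cong (Δind Q) (solve 3 (λ z t q → z :+ t :- q := (z :- q) :+ t) refl z t (+ q))) (Δind-periodic Q (z - + q) t L∣t))

  periodic-affine : ∀ {F} → Periodic L F → ∀ c d → Periodic L (λ x → F (c + x * d))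
  periodic-affine {F} F-periodic c d z t L∣t =
    trans (cong F (solve 4 (λ c z t d → c :+ (z :+ t) :* d := (c :+ z :* d) :+ t :* d) refl c z t d))
          (F-periodic (c + z * d) (t * d) (ℤ∣.∣m⇒∣m*n d L∣t))

  -- x ↦ x - y turns the shift by q into the shift by d, under which the sum over a period is invariant.
  sumBelow-Δind-affine-vanishes : ∀ Q {q} y d → q List.∈ Q → (+ L) ∣ (y * d - + q) →
                                  ∀ c → sumBelow L (λ x → Δind Q (c + x * d)) ≡ 0ℤ
  sumBelow-Δind-affine-vanishes (q ∷ Q) y d (Any.here refl) L∣yd-q c = begin
      sumBelow L (λ x → Δind Q (c + x * d) - Δind Q (c + x * d - + q))
        ≡⟨ sumBelow-- L G (λ x → Δind Q (c + x * d - + q)) ⟩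
      sumBelow L G - sumBelow L (λ x → Δind Q (c + x * d - + q))
        ≡⟨ cong (_-_ (sumBelow L G)) (sumBelow-cong L (λ x →
             trans (cong (Δind Q) (split x)) (Δind-periodic Q (c + (x + - y) * d) (y * d - + q) L∣yd-q))) ⟩
      sumBelow L G - sumBelow L (λ x → G (x + - y))
        ≡⟨ cong (_-_ (sumBelow L G)) (sumBelow-periodic-shift L (periodic-affine (Δind-periodic Q) c d) (- y)) ⟩
      sumBelow L G - sumBelow L G
        ≡⟨ ℤP.+-inverseʳ (sumBelow L G) ⟩
      0ℤ ∎
    where
    open ≡-Reasoning
    G = λ x → Δind Q (c + x * d)
    split : ∀ x → c + x * d - + q ≡ c + (x + - y) * d + (y * d - + q)
    split x = solve 5 (λ c x d q y → c :+ x :* d :- q := c :+ (x :+ :- y) :* d :+ (y :* d :- q)) refl c x d (+ q) y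
  sumBelow-Δind-affine-vanishes (q′ ∷ Q) y d (Any.there q∈Q) L∣yd-q c = begin
      sumBelow L (λ x → Δind Q (c + x * d) - Δind Q (c + x * d - + q′))
        ≡⟨ sumBelow-- L (λ x → Δind Q (c + x * d)) (λ x → Δind Q (c + x * d - + q′)) ⟩
      sumBelow L (λ x → Δind Q (c + x * d)) - sumBelow L (λ x → Δind Q (c + x * d - + q′))
        ≡⟨ cong₂ _-_ (sumBelow-Δind-affine-vanishes Q y d q∈Q L∣yd-q c)
             (trans (sumBelow-cong L (λ x → cong (Δind Q) (solve 4 (λ c x d q → c :+ x :* d :- q := (c :- q) :+ x :* d) refl c x d (+ q′))))
                    (sumBelow-Δind-affine-vanishes Q y d q∈Q L∣yd-q (c - + q′))) ⟩
      0ℤ - 0ℤ ∎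
    where open ≡-Reasoning

  sumBelow-Δind-affine-multiple : ∀ Q d → (+ L) ∣ d → ∀ c → sumBelow L (λ x → Δind Q (c + x * d)) ≡ + L * Δind Q c
  sumBelow-Δind-affine-multiple Q d L∣d c =
    trans (sumBelow-cong L (λ x → Δind-periodic Q c (x * d) (ℤ∣.∣n⇒∣m*n x L∣d))) (sumBelow-const L (Δind Q c))

  cofactor : ℕ → ℕ
  cofactor zero = 0
  cofactor (suc p) = L ℕ./ suc p

  cofactor-spec : ∀ p t → L ≡ t ℕ.* p → cofactor p ≡ t
  cofactor-spec zero t L≡t*0 = ⊥-elim (ℕ.≢-nonZero⁻¹ L (trans L≡t*0 (ℕP.*-zeroʳ t)))
  cofactor-spec (suc p) t L≡t*p = trans (cong (ℕ._/ suc p) L≡t*p) (ℕDM.m*n/n≡m t (suc p))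

  cofactor*p≡L : ∀ {p} → p ℕ∣.∣ L → cofactor p ℕ.* p ≡ L
  cofactor*p≡L {p} (ℕ∣.divides t L≡t*p) = trans (cong (ℕ._* p) (cofactor-spec p t L≡t*p)) (sym L≡t*p)

  PrimeDivisor : ℕ → Set
  PrimeDivisor p = Prime p × p ℕ∣.∣ L

  primeDivisor? : Decidable PrimeDivisor
  primeDivisor? p = prime? p ×-dec (p ℕ∣.∣? L)

  primeDivisors : List ℕ
  primeDivisors = filter primeDivisor? (List.upTo (suc L))

  ∈-primeDivisors : ∀ {p} → PrimeDivisor p → p List.∈ primeDivisors
  ∈-primeDivisors {p} (p-prime , p∣L) = ∈-filter⁺ primeDivisor? (∈-upTo⁺ (s≤s (ℕ∣.∣⇒≤ p∣L))) (p-prime , p∣L)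

  primeDivisors-unique : Unique primeDivisors
  primeDivisors-unique = UniqueP.filter⁺ primeDivisor? (UniqueP.upTo⁺ (suc L))

  primeDivisors-all : All PrimeDivisor primeDivisors
  primeDivisors-all = All.tabulate (proj₂ ∘ ∈-filter⁻ primeDivisor? {xs = List.upTo (suc L)})

  bezout-mod : ∀ a g → Bézout.Identity g a L → ∃[ u ] ((+ L) ∣ (u * + a - + g))
  bezout-mod a g (Bézout.+- x y g+yL≡xa) = + x , divides (+ y) (begin
      + x * + a - + g            ≡⟨ cong (_- + g) (trans (sym (ℤP.pos-* x a)) (cong +_ (sym g+yL≡xa))) ⟩
      + (g ℕ.+ y ℕ.* L) - + g    ≡⟨ cong (_- + g) (trans (ℤP.pos-+ g (y ℕ.* L)) (cong (_+_ (+ g)) (ℤP.pos-* y L))) ⟩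
      (+ g + + y * + L) - + g    ≡⟨ solve 3 (λ g y l → (g :+ y :* l) :- g := y :* l) refl (+ g) (+ y) (+ L) ⟩
      + y * + L                  ∎)
    where open ≡-Reasoning
  bezout-mod a g (Bézout.-+ x y g+xa≡yL) = - + x , divides (- + y) (begin
      - + x * + a - + g          ≡⟨ solve 3 (λ x a g → :- x :* a :- g := :- (g :+ x :* a)) refl (+ x) (+ a) (+ g) ⟩
      - (+ g + + x * + a)        ≡⟨ cong -_ (trans (cong (_+_ (+ g)) (sym (ℤP.pos-* x a))) (sym (ℤP.pos-+ g (x ℕ.* a)))) ⟩
      - + (g ℕ.+ x ℕ.* a)        ≡⟨ cong (λ t → - + t) g+xa≡yL ⟩
      - + (y ℕ.* L)              ≡⟨ trans (cong -_ (ℤP.pos-* y L)) (ℤP.neg-distribˡ-* (+ y) (+ L)) ⟩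
      - + y * + L                ∎)
    where open ≡-Reasoning

  abs-as-multiple : ∀ d → ∃[ s ] (+ ℤ.∣ d ∣ ≡ s * d)
  abs-as-multiple (+ n) = 1ℤ , sym (ℤP.*-identityˡ (+ n))
  abs-as-multiple ℤ.-[1+ n ] = - 1ℤ , sym (ℤP.-1*i≡-i ℤ.-[1+ n ])

  -- g = gcd(∣d∣, L) is a proper divisor of L; for a prime p ∣ L / g, cofactor p is a multiple of g, and g ≡ u ∣d∣ (mod L).
  ∃-cofactor-multiple : ∀ d → ¬ (+ L) ∣ d → ∃[ p ] (p List.∈ primeDivisors × ∃[ y ] ((+ L) ∣ (y * d - + cofactor p)))
  ∃-cofactor-multiple d L∤d with Bézout.lemma ℤ.∣ d ∣ L
  ... | Bézout.result g gcd bezout with GCD.gcd∣n gcd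
  ... | ℕ∣.divides o L≡o*g = from-factor (factorise o {{o≢0}})
    where
    o≢0 : NonZero o
    o≢0 = ℕ.≢-nonZero (λ o≡0 → ℕ.≢-nonZero⁻¹ L (trans L≡o*g (cong (ℕ._* g) o≡0)))
    o≢1 : o ≢ 1
    o≢1 o≡1 = L∤d (ℤ∣.∣ᵤ⇒∣ (subst (ℕ∣._∣ ℤ.∣ d ∣) (sym (trans L≡o*g (trans (cong (ℕ._* g) o≡1) (ℕP.*-identityˡ g)))) (GCD.gcd∣m gcd)))
    from-factor : PrimeFactorisation o → ∃[ p ] (p List.∈ primeDivisors × ∃[ y ] ((+ L) ∣ (y * d - + cofactor p)))
    from-factor record { factors = [] ; isFactorisation = 1≡o } = ⊥-elim (o≢1 1≡o)
    from-factor record { factors = p ∷ ps ; isFactorisation = p*r≡o ; factorsPrime = p-prime All.∷ _ } =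
        p , ∈-primeDivisors (p-prime , ℕ∣.divides (r ℕ.* g) L≡rg*p) , u * s * + r , L∣y*d-cofactor
      where
      r = product ps
      L≡rg*p : L ≡ (r ℕ.* g) ℕ.* p
      L≡rg*p = trans L≡o*g (trans (cong (ℕ._* g) p*r≡o) (rearrange p r g))
        where
        rearrange : ∀ p r g → (p ℕ.* r) ℕ.* g ≡ (r ℕ.* g) ℕ.* p
        rearrange = ℕRing.solve-∀
      s = proj₁ (abs-as-multiple d)
      u = proj₁ (bezout-mod ℤ.∣ d ∣ g bezout)
      L∣y*d-cofactor : (+ L) ∣ (u * s * + r * d - + cofactor p)
      L∣y*d-cofactor = subst ((+ L) ∣_) (begin
          + r * (u * + ℤ.∣ d ∣ - + g)    ≡⟨ cong (λ t → + r * (u * t - + g)) (proj₂ (abs-as-multiple d)) ⟩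
          + r * (u * (s * d) - + g)      ≡⟨ solve 5 (λ r u s d g → r :* (u :* (s :* d) :- g) := u :* s :* r :* d :- r :* g) refl (+ r) u s d (+ g) ⟩
          u * s * + r * d - + r * + g    ≡⟨ cong (λ t → u * s * + r * d - t) (trans (sym (ℤP.pos-* r g)) (cong +_ (sym (cofactor-spec p (r ℕ.* g) L≡rg*p)))) ⟩
          u * s * + r * d - + cofactor p ∎) (ℤ∣.∣n⇒∣m*n (+ r) (proj₂ (bezout-mod ℤ.∣ d ∣ g bezout)))
        where open ≡-Reasoning

  cofactorSum : List ℕ → ℕ
  cofactorSum = sum ∘ List.map cofactor

  L∣R*cofactorSum : ∀ R U → All (λ p → p ℕ∣.∣ R × p ℕ∣.∣ L) U → L ℕ∣.∣ R ℕ.* cofactorSum U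
  L∣R*cofactorSum R [] All.[] = subst (L ℕ∣.∣_) (sym (ℕP.*-zeroʳ R)) (L ℕ∣.∣0)
  L∣R*cofactorSum R (p ∷ U) ((ℕ∣.divides t R≡t*p , p∣L) All.∷ p∣R,L) =
    subst (L ℕ∣.∣_) (sym (ℕP.*-distribˡ-+ R (cofactor p) (cofactorSum U)))
      (ℕ∣.∣m∣n⇒∣m+n (ℕ∣.divides t (begin
         R ℕ.* cofactor p         ≡⟨ cong (ℕ._* cofactor p) R≡t*p ⟩
         t ℕ.* p ℕ.* cofactor p   ≡⟨ ℕP.*-assoc t p (cofactor p) ⟩
         t ℕ.* (p ℕ.* cofactor p) ≡⟨ cong (t ℕ.*_) (trans (ℕP.*-comm p (cofactor p)) (cofactor*p≡L p∣L)) ⟩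
         t ℕ.* L                  ∎)) (L∣R*cofactorSum R U p∣R,L))
    where open ≡-Reasoning

  -- Multiplying by R = ∏ U kills every cofactor but that of p₀, and L ∣ R · cofactor p₀ forces p₀ ∣ R.
  L∤cofactorSum : ∀ p₀ U → Unique (p₀ ∷ U) → All PrimeDivisor (p₀ ∷ U) → ¬ L ℕ∣.∣ cofactorSum (p₀ ∷ U)
  L∤cofactorSum p₀ U (p₀∉U AllPairs.∷ _) ((p₀-prime , p₀∣L) All.∷ U-primeDivisors) L∣sum =
    All.lookup p₀∉U p₀∈U refl
    where
    R = product U
    L∣R*cofactor : L ℕ∣.∣ R ℕ.* cofactor p₀
    L∣R*cofactor = ℕ∣.∣m+n∣m⇒∣n
      (subst (L ℕ∣.∣_) (trans (ℕP.*-distribˡ-+ R (cofactor p₀) (cofactorSum U)) (ℕP.+-comm (R ℕ.* cofactor p₀) _)) (ℕ∣.∣n⇒∣m*n R L∣sum))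
      (L∣R*cofactorSum R U (All.tabulate (λ p∈U → ∈⇒∣product p∈U , proj₂ (All.lookup U-primeDivisors p∈U))))
    cofactor≢0 : NonZero (cofactor p₀)
    cofactor≢0 = ℕ.≢-nonZero (λ c≡0 → ℕ.≢-nonZero⁻¹ L (trans (sym (cofactor*p≡L p₀∣L)) (cong (ℕ._* p₀) c≡0)))
    p₀∣R : p₀ ℕ∣.∣ R
    p₀∣R = ℕ∣.*-cancelˡ-∣ (cofactor p₀) {{cofactor≢0}}
             (subst₂ ℕ∣._∣_ (sym (cofactor*p≡L p₀∣L)) (ℕP.*-comm R (cofactor p₀)) L∣R*cofactor)
    p₀∈U : p₀ List.∈ U
    p₀∈U = factorisationHasAllPrimeFactors p₀-prime p₀∣R (All.map proj₁ U-primeDivisors)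

  isEmpty : List ℕ → ℤ
  isEmpty [] = 1ℤ
  isEmpty (_ ∷ _) = 0ℤ

  Δind-cofactorSum : ∀ P U → Unique (P ++ U) → All PrimeDivisor (P ++ U) →
                     Δind (List.map cofactor P) (- + cofactorSum U) ≡ isEmpty U
  Δind-cofactorSum [] [] _ _ = ind-yes (divides 0ℤ refl)
  Δind-cofactorSum [] (p₀ ∷ U) unique primeDivs =
    ind-no (λ L∣-sum → L∤cofactorSum p₀ U unique primeDivs
      (subst (L ℕ∣.∣_) (ℤP.∣-i∣≡∣i∣ (+ cofactorSum (p₀ ∷ U))) (ℤ∣.∣⇒∣ᵤ L∣-sum)))
  Δind-cofactorSum (p ∷ P) U unique primeDivs = begin
      Δind (List.map cofactor P) (- + cofactorSum U) - Δind (List.map cofactor P) (- + cofactorSum U - + cofactor p)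
        ≡⟨ cong₂ _-_ (Δind-cofactorSum P U (Unique.tail unique) (All.tail primeDivs))
             (trans (cong (Δind (List.map cofactor P)) move-p)
                    (Δind-cofactorSum P (p ∷ U) (Unique-resp-↭ (↭⇒↭ₛ p∷P++U↭P++p∷U) unique) (All-resp-↭ p∷P++U↭P++p∷U primeDivs))) ⟩
      isEmpty U - 0ℤ ≡⟨ ℤP.+-identityʳ (isEmpty U) ⟩
      isEmpty U ∎
    where
    open ≡-Reasoning
    p∷P++U↭P++p∷U : (p ∷ P ++ U) ↭ (P ++ p ∷ U)
    p∷P++U↭P++p∷U = ↭-sym (shift p P U)
    move-p : - + cofactorSum U - + cofactor p ≡ - + cofactorSum (p ∷ U)
    move-p = trans (solve 2 (λ s q → :- s :- q := :- (q :+ s)) refl (+ cofactorSum U) (+ cofactor p))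
                   (cong -_ (sym (ℤP.pos-+ (cofactor p) (cofactorSum U))))

  sieve : ℤ → ℤ
  sieve = Δind (List.map cofactor primeDivisors)

  sieve-periodic : Periodic L sieve
  sieve-periodic = Δind-periodic (List.map cofactor primeDivisors)

  sieve-0 : sieve 0ℤ ≡ 1ℤ
  sieve-0 = Δind-cofactorSum primeDivisors []
    (subst Unique (sym (ListP.++-identityʳ primeDivisors)) primeDivisors-unique)
    (subst (All PrimeDivisor) (sym (ListP.++-identityʳ primeDivisors)) primeDivisors-all)

  sumBelow-sieve-affine : ∀ c d → sumBelow L (λ x → sieve (c + x * d)) ≡ + L * (ind d * sieve c)
  sumBelow-sieve-affine c d with (+ L) ∣? d
  ... | yes L∣d = trans (sumBelow-Δind-affine-multiple (List.map cofactor primeDivisors) d L∣d c)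
                        (cong (+ L *_) (sym (ℤP.*-identityˡ (sieve c))))
  ... | no L∤d with ∃-cofactor-multiple d L∤d
  ...   | p , p∈ , y , L∣yd-cofactor =
    trans (sumBelow-Δind-affine-vanishes (List.map cofactor primeDivisors) y d (∈-map⁺ cofactor p∈) L∣yd-cofactor c)
          (sym (ℤP.*-zeroʳ (+ L)))

-- Power sums and the Vandermonde determinant

powerSum : List ℕ → (r x : ℕ → ℤ) → ℕ → ℤ
powerSum [] r x j = 0ℤ
powerSum (i ∷ ℓ) r x j = r i * x i ^ j + powerSum ℓ r x j

prodDiff : ℤ → List ℕ → (ℕ → ℤ) → ℤ
prodDiff c [] x = 1ℤ
prodDiff c (i ∷ ℓ) x = (c - x i) * prodDiff c ℓ x

powerSum-cong : ∀ ℓ {r r′ : ℕ → ℤ} x j → (∀ i → r i ≡ r′ i) → powerSum ℓ r x j ≡ powerSum ℓ r′ x j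
powerSum-cong [] x j r≡r′ = refl
powerSum-cong (i ∷ ℓ) x j r≡r′ = cong₂ (λ a b → a * x i ^ j + b) (r≡r′ i) (powerSum-cong ℓ x j r≡r′)

powerSum-zero : ∀ ℓ {r : ℕ → ℤ} x j → (∀ i → r i ≡ 0ℤ) → powerSum ℓ r x j ≡ 0ℤ
powerSum-zero [] x j r≡0 = refl
powerSum-zero (i ∷ ℓ) x j r≡0 = cong₂ (λ a b → a * x i ^ j + b) (r≡0 i) (powerSum-zero ℓ x j r≡0)

powerSum-altSum : ∀ ℓ {k} (h : ℕ → Subset k → ℤ) x j →
                  powerSum ℓ (λ i → altSum (h i)) x j ≡ altSum (λ I → powerSum ℓ (λ i → h i I) x j)
powerSum-altSum [] {k} h x j = sym (altSum-zero {k} (λ I → refl))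
powerSum-altSum (i ∷ ℓ) h x j = trans (cong₂ _+_ (sym (altSum-*ʳ (h i) (x i ^ j))) (powerSum-altSum ℓ h x j))
  (sym (altSum-+ (λ I → h i I * x i ^ j) (λ I → powerSum ℓ (λ i′ → h i′ I) x j)))

powerSum-*-sub : ∀ ℓ r x c j → powerSum ℓ (λ i → r i * (x i - c)) x j ≡ powerSum ℓ r x (suc j) - c * powerSum ℓ r x j
powerSum-*-sub [] r x c j = cong (_-_ 0ℤ) (sym (ℤP.*-zeroʳ c))
powerSum-*-sub (i ∷ ℓ) r x c j = trans (cong (_+_ (r i * (x i - c) * x i ^ j)) (powerSum-*-sub ℓ r x c j))
  (solve 6 (λ r x c p m₁ m₀ → r :* (x :- c) :* p :+ (m₁ :- c :* m₀) := (r :* (x :* p) :+ m₁) :- c :* (r :* p :+ m₀)) refl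
     (r i) (x i) c (x i ^ j) (powerSum ℓ r x (suc j)) (powerSum ℓ r x j))

-- Multiplying the weights by x i - x i₁ kills the point i₁ and trades moment j+1 for
-- moment j, so the Vandermonde determinant is peeled off one factor at a time.
powerSum-vandermonde : ∀ ℓ i₀ (r x : ℕ → ℤ) → (∀ j → j < length ℓ → powerSum (i₀ ∷ ℓ) r x j ≡ 0ℤ) →
                       powerSum (i₀ ∷ ℓ) r x (length ℓ) ≡ r i₀ * prodDiff (x i₀) ℓ x
powerSum-vandermonde [] i₀ r x _ = ℤP.+-identityʳ (r i₀ * 1ℤ)
powerSum-vandermonde (i₁ ∷ ℓ) i₀ r x low≡0 = begin
    M (suc n)                           ≡⟨ solve 2 (λ a b → a := a :- b :* con 0ℤ) refl (M (suc n)) (x i₁) ⟩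
    M (suc n) - x i₁ * 0ℤ               ≡⟨ cong (λ t → M (suc n) - x i₁ * t) (sym (low≡0 n (ℕP.n<1+n n))) ⟩
    M (suc n) - x i₁ * M n              ≡⟨ sym (powerSum-*-sub (i₀ ∷ i₁ ∷ ℓ) r x (x i₁) n) ⟩
    powerSum (i₀ ∷ i₁ ∷ ℓ) r′ x n       ≡⟨ drop-i₁ n ⟩
    powerSum (i₀ ∷ ℓ) r′ x n            ≡⟨ powerSum-vandermonde ℓ i₀ r′ x low′≡0 ⟩
    r′ i₀ * prodDiff (x i₀) ℓ x         ≡⟨ ℤP.*-assoc (r i₀) (x i₀ - x i₁) (prodDiff (x i₀) ℓ x) ⟩
    r i₀ * prodDiff (x i₀) (i₁ ∷ ℓ) x   ∎
  where
  open ≡-Reasoning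
  n = length ℓ
  M = powerSum (i₀ ∷ i₁ ∷ ℓ) r x
  r′ = λ i → r i * (x i - x i₁)
  drop-i₁ : ∀ j → powerSum (i₀ ∷ i₁ ∷ ℓ) r′ x j ≡ powerSum (i₀ ∷ ℓ) r′ x j
  drop-i₁ j = cong (_+_ (r′ i₀ * x i₀ ^ j)) (begin
      r i₁ * (x i₁ - x i₁) * x i₁ ^ j + powerSum ℓ r′ x j
        ≡⟨ cong (λ t → r i₁ * t * x i₁ ^ j + powerSum ℓ r′ x j) (ℤP.+-inverseʳ (x i₁)) ⟩
      r i₁ * 0ℤ * x i₁ ^ j + powerSum ℓ r′ x j
        ≡⟨ cong (λ t → t * x i₁ ^ j + powerSum ℓ r′ x j) (ℤP.*-zeroʳ (r i₁)) ⟩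
      0ℤ * x i₁ ^ j + powerSum ℓ r′ x j
        ≡⟨ ℤP.+-identityˡ (powerSum ℓ r′ x j) ⟩
      powerSum ℓ r′ x j ∎)
  low′≡0 : ∀ j → j < n → powerSum (i₀ ∷ ℓ) r′ x j ≡ 0ℤ
  low′≡0 j j<n = begin
      powerSum (i₀ ∷ ℓ) r′ x j             ≡⟨ sym (drop-i₁ j) ⟩
      powerSum (i₀ ∷ i₁ ∷ ℓ) r′ x j        ≡⟨ powerSum-*-sub (i₀ ∷ i₁ ∷ ℓ) r x (x i₁) j ⟩
      M (suc j) - x i₁ * M j               ≡⟨ cong₂ (λ a b → a - x i₁ * b) (low≡0 (suc j) (s≤s j<n)) (low≡0 j (ℕP.m<n⇒m<1+n j<n)) ⟩
      0ℤ - x i₁ * 0ℤ                       ≡⟨ cong (_-_ 0ℤ) (ℤP.*-zeroʳ (x i₁)) ⟩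
      0ℤ                                   ∎

range : ℕ → ℕ → List ℕ
range a zero = []
range a (suc n) = a ∷ range (suc a) n

range-++ : ∀ a n₁ n₂ → range a (n₁ ℕ.+ n₂) ≡ range a n₁ ++ range (a ℕ.+ n₁) n₂
range-++ a zero n₂ = cong (λ t → range t n₂) (sym (ℕP.+-identityʳ a))
range-++ a (suc n₁) n₂ = cong (a ∷_) (trans (range-++ (suc a) n₁ n₂) (cong (λ t → range (suc a) n₁ ++ range t n₂) (sym (ℕP.+-suc a n₁))))

length-range : ∀ a n → length (range a n) ≡ n
length-range a zero = refl
length-range a (suc n) = cong suc (length-range (suc a) n)

powerSum-++ : ∀ A B r x j → powerSum (A ++ B) r x j ≡ powerSum A r x j + powerSum B r x j
powerSum-++ [] B r x j = sym (ℤP.+-identityˡ (powerSum B r x j))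
powerSum-++ (i ∷ A) B r x j = trans (cong (_+_ (r i * x i ^ j)) (powerSum-++ A B r x j))
  (sym (ℤP.+-assoc (r i * x i ^ j) (powerSum A r x j) (powerSum B r x j)))

powerSum-++-∷ : ∀ A i B r x j → powerSum (A ++ i ∷ B) r x j ≡ powerSum (i ∷ A ++ B) r x j
powerSum-++-∷ A i B r x j = begin
    powerSum (A ++ i ∷ B) r x j
      ≡⟨ powerSum-++ A (i ∷ B) r x j ⟩
    powerSum A r x j + (r i * x i ^ j + powerSum B r x j)
      ≡⟨ solve 3 (λ a t b → a :+ (t :+ b) := t :+ (a :+ b)) refl (powerSum A r x j) (r i * x i ^ j) (powerSum B r x j) ⟩
    r i * x i ^ j + (powerSum A r x j + powerSum B r x j)
      ≡⟨ cong (_+_ (r i * x i ^ j)) (sym (powerSum-++ A B r x j)) ⟩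
    powerSum (i ∷ A ++ B) r x j ∎
  where open ≡-Reasoning

range-without : ℕ → ℕ → List ℕ
range-without m i₀ = range 0 i₀ ++ range (suc i₀) (m ℕ.∸ i₀)

range-split : ∀ m i₀ → i₀ ≤ m → range 0 (suc m) ≡ range 0 i₀ ++ i₀ ∷ range (suc i₀) (m ℕ.∸ i₀)
range-split m i₀ i₀≤m = trans (cong (range 0) (sym i₀+[m-i₀+1]≡m+1)) (range-++ 0 i₀ (suc (m ℕ.∸ i₀)))
  where
  i₀+[m-i₀+1]≡m+1 : i₀ ℕ.+ suc (m ℕ.∸ i₀) ≡ suc m
  i₀+[m-i₀+1]≡m+1 = trans (ℕP.+-suc i₀ (m ℕ.∸ i₀)) (cong suc (ℕP.m+[n∸m]≡n i₀≤m))

length-range-without : ∀ m i₀ → i₀ ≤ m → length (range-without m i₀) ≡ m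
length-range-without m i₀ i₀≤m = trans (ListP.length-++ (range 0 i₀))
  (trans (cong₂ ℕ._+_ (length-range 0 i₀) (length-range (suc i₀) (m ℕ.∸ i₀))) (ℕP.m+[n∸m]≡n i₀≤m))

powerSum-range-vandermonde : ∀ m i₀ → i₀ ≤ m → (r x : ℕ → ℤ) → (∀ j → j < m → powerSum (range 0 (suc m)) r x j ≡ 0ℤ) →
                             powerSum (range 0 (suc m)) r x m ≡ r i₀ * prodDiff (x i₀) (range-without m i₀) x
powerSum-range-vandermonde m i₀ i₀≤m r x low≡0 = begin
    powerSum (range 0 (suc m)) r x m
      ≡⟨ i₀-first m ⟩
    powerSum (i₀ ∷ range-without m i₀) r x m
      ≡⟨ cong (powerSum (i₀ ∷ range-without m i₀) r x) (sym (length-range-without m i₀ i₀≤m)) ⟩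
    powerSum (i₀ ∷ range-without m i₀) r x (length (range-without m i₀))
      ≡⟨ powerSum-vandermonde (range-without m i₀) i₀ r x low′≡0 ⟩
    r i₀ * prodDiff (x i₀) (range-without m i₀) x ∎
  where
  open ≡-Reasoning
  i₀-first : ∀ j → powerSum (range 0 (suc m)) r x j ≡ powerSum (i₀ ∷ range-without m i₀) r x j
  i₀-first j = trans (cong (λ ℓ → powerSum ℓ r x j) (range-split m i₀ i₀≤m)) (powerSum-++-∷ (range 0 i₀) i₀ (range (suc i₀) (m ℕ.∸ i₀)) r x j)
  low′≡0 : ∀ j → j < length (range-without m i₀) → powerSum (i₀ ∷ range-without m i₀) r x j ≡ 0ℤ
  low′≡0 j j< = trans (sym (i₀-first j)) (low≡0 j (subst (j <_) (length-range-without m i₀ i₀≤m) j<))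

productOver : List ℕ → (ℕ → ℕ) → ℕ
productOver [] f = 1
productOver (i ∷ ℓ) f = f i ℕ.* productOver ℓ f

∣prodDiff∣ : ∀ c ℓ x → ℤ.∣ prodDiff c ℓ x ∣ ≡ productOver ℓ (λ i → ℤ.∣ c - x i ∣)
∣prodDiff∣ c [] x = refl
∣prodDiff∣ c (i ∷ ℓ) x = trans (ℤP.abs-* (c - x i) (prodDiff c ℓ x)) (cong (ℤ.∣ c - x i ∣ ℕ.*_) (∣prodDiff∣ c ℓ x))

productOver-cong : ∀ ℓ {f g} → (∀ i → f i ≡ g i) → productOver ℓ f ≡ productOver ℓ g
productOver-cong [] f≡g = refl
productOver-cong (i ∷ ℓ) f≡g = cong₂ ℕ._*_ (f≡g i) (productOver-cong ℓ f≡g)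

productOver-++ : ∀ A B f → productOver (A ++ B) f ≡ productOver A f ℕ.* productOver B f
productOver-++ [] B f = sym (ℕP.+-identityʳ (productOver B f))
productOver-++ (i ∷ A) B f = trans (cong (f i ℕ.*_) (productOver-++ A B f)) (sym (ℕP.*-assoc (f i) (productOver A f) (productOver B f)))

productOver-*ʳ : ∀ ℓ d L → productOver ℓ (λ i → d i ℕ.* L) ≡ L ℕ.^ length ℓ ℕ.* productOver ℓ d
productOver-*ʳ [] d L = refl
productOver-*ʳ (i ∷ ℓ) d L = trans (cong (d i ℕ.* L ℕ.*_) (productOver-*ʳ ℓ d L)) (rearrange (d i) L (L ℕ.^ length ℓ) (productOver ℓ d))
  where
  rearrange : ∀ a l p q → a ℕ.* l ℕ.* (p ℕ.* q) ≡ l ℕ.* p ℕ.* (a ℕ.* q)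
  rearrange = ℕRing.solve-∀

productOver-cong-range : ∀ a n {f g} → (∀ i → a ≤ i → i < a ℕ.+ n → f i ≡ g i) → productOver (range a n) f ≡ productOver (range a n) g
productOver-cong-range a zero f≡g = refl
productOver-cong-range a (suc n) f≡g = cong₂ ℕ._*_ (f≡g a ℕP.≤-refl (ℕP.m<m+n a ℕ.z<s))
  (productOver-cong-range (suc a) n (λ i a<i i<a+n → f≡g i (ℕP.<⇒≤ a<i) (subst (i <_) (sym (ℕP.+-suc a n)) i<a+n)))

productOver-range-distance-to-end : ∀ a n → productOver (range a n) (λ i → (a ℕ.+ n) ℕ.∸ i) ≡ n ℕ.!
productOver-range-distance-to-end a zero = refl
productOver-range-distance-to-end a (suc n) = cong₂ ℕ._*_ (ℕP.m+n∸m≡n a (suc n))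
  (trans (productOver-cong (range (suc a) n) (λ i → cong (ℕ._∸ i) (ℕP.+-suc a n))) (productOver-range-distance-to-end (suc a) n))

productOver-range-distance-from : ∀ c n → productOver (range (suc c) n) (λ i → i ℕ.∸ c) ≡ n ℕ.!
productOver-range-distance-from c zero = refl
productOver-range-distance-from c (suc n) = begin
    productOver (range (suc c) (suc n)) f
      ≡⟨ cong (λ ℓ → productOver ℓ f) (trans (cong (range (suc c)) (ℕP.+-comm 1 n)) (range-++ (suc c) n 1)) ⟩
    productOver (range (suc c) n ++ range (suc c ℕ.+ n) 1) f
      ≡⟨ productOver-++ (range (suc c) n) (range (suc c ℕ.+ n) 1) f ⟩
    productOver (range (suc c) n) f ℕ.* ((suc c ℕ.+ n ℕ.∸ c) ℕ.* 1)
      ≡⟨ cong₂ ℕ._*_ (productOver-range-distance-from c n)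
           (trans (ℕP.*-identityʳ _) (trans (cong (ℕ._∸ c) (sym (ℕP.+-suc c n))) (ℕP.m+n∸m≡n c (suc n)))) ⟩
    n ℕ.! ℕ.* suc n
      ≡⟨ ℕP.*-comm (n ℕ.!) (suc n) ⟩
    suc n ℕ.! ∎
  where
  open ≡-Reasoning
  f = λ i → i ℕ.∸ c

∣m-n∣≡m∸n : ∀ {m n} → n ≤ m → ℤ.∣ + m - + n ∣ ≡ m ℕ.∸ n
∣m-n∣≡m∸n {m} {n} n≤m = trans (cong ℤ.∣_∣ (ℤP.m-n≡m⊖n m n)) (cong ℤ.∣_∣ (ℤP.⊖-≥ n≤m))

∣m-n∣≡n∸m : ∀ {m n} → m ≤ n → ℤ.∣ + m - + n ∣ ≡ n ℕ.∸ m
∣m-n∣≡n∸m {m} {n} m≤n = trans (ℤP.∣i-j∣≡∣j-i∣ (+ m) (+ n)) (∣m-n∣≡m∸n m≤n)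

∣prodDiff-progression∣ : ∀ (ρ : ℤ) (L m i₀ : ℕ) → i₀ ≤ m →
  ℤ.∣ prodDiff (ρ + + i₀ * + L) (range-without m i₀) (λ i → ρ + + i * + L) ∣ ≡ L ℕ.^ m ℕ.* (i₀ ℕ.! ℕ.* (m ℕ.∸ i₀) ℕ.!)
∣prodDiff-progression∣ ρ L m i₀ i₀≤m = begin
    ℤ.∣ prodDiff (x i₀) ℓ x ∣                         ≡⟨ ∣prodDiff∣ (x i₀) ℓ x ⟩
    productOver ℓ (λ i → ℤ.∣ x i₀ - x i ∣)           ≡⟨ productOver-cong ℓ ∣xᵢ₀-xᵢ∣ ⟩
    productOver ℓ (λ i → d i ℕ.* L)                   ≡⟨ productOver-*ʳ ℓ d L ⟩
    L ℕ.^ length ℓ ℕ.* productOver ℓ d               ≡⟨ cong₂ (λ a b → L ℕ.^ a ℕ.* b) (length-range-without m i₀ i₀≤m)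
                                                                                (productOver-++ (range 0 i₀) (range (suc i₀) (m ℕ.∸ i₀)) d) ⟩
    L ℕ.^ m ℕ.* (productOver (range 0 i₀) d ℕ.* productOver (range (suc i₀) (m ℕ.∸ i₀)) d)
                                                      ≡⟨ cong (L ℕ.^ m ℕ.*_) (cong₂ ℕ._*_ below above) ⟩
    L ℕ.^ m ℕ.* (i₀ ℕ.! ℕ.* (m ℕ.∸ i₀) ℕ.!)          ∎
  where
  open ≡-Reasoning
  x = λ i → ρ + + i * + L
  ℓ = range-without m i₀
  d = λ i → ℤ.∣ + i₀ - + i ∣
  ∣xᵢ₀-xᵢ∣ : ∀ i → ℤ.∣ x i₀ - x i ∣ ≡ d i ℕ.* L
  ∣xᵢ₀-xᵢ∣ i = trans (cong ℤ.∣_∣ (solve 4 (λ r a b l → (r :+ a :* l) :- (r :+ b :* l) := (a :- b) :* l) refl ρ (+ i₀) (+ i) (+ L)))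
                    (ℤP.abs-* (+ i₀ - + i) (+ L))
  below : productOver (range 0 i₀) d ≡ i₀ ℕ.!
  below = trans (productOver-cong-range 0 i₀ (λ i _ i<i₀ → ∣m-n∣≡m∸n (ℕP.<⇒≤ i<i₀))) (productOver-range-distance-to-end 0 i₀)
  above : productOver (range (suc i₀) (m ℕ.∸ i₀)) d ≡ (m ℕ.∸ i₀) ℕ.!
  above = trans (productOver-cong-range (suc i₀) (m ℕ.∸ i₀) (λ i i₀<i _ → ∣m-n∣≡n∸m (ℕP.<⇒≤ i₀<i)))
                (productOver-range-distance-from i₀ (m ℕ.∸ i₀))

k![n∸k]!<n! : ∀ {k n} → 0 < k → k < n → k ℕ.! ℕ.* (n ℕ.∸ k) ℕ.! < n ℕ.!
k![n∸k]!<n! {suc k} {suc n} _ (s≤s k<n) = begin-strict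
    suc k ℕ.! ℕ.* (n ℕ.∸ k) ℕ.!      ≡⟨ ℕP.*-assoc (suc k) (k ℕ.!) ((n ℕ.∸ k) ℕ.!) ⟩
    suc k ℕ.* (k ℕ.! ℕ.* (n ℕ.∸ k) ℕ.!) ≤⟨ ℕP.*-monoʳ-≤ (suc k) (ℕ∣.∣⇒≤ {{ℕP._!≢0 n}} (k![n∸k]!∣n! (ℕP.<⇒≤ k<n))) ⟩
    suc k ℕ.* n ℕ.!                  <⟨ ℕP.*-monoˡ-< (n ℕ.!) {{ℕP._!≢0 n}} (s≤s k<n) ⟩
    suc n ℕ.!                        ∎
  where open ℕP.≤-Reasoning

kronecker : ℕ → ℕ → ℤ
kronecker a b = + 𝟙 (a ℕ.≟ b)

kronecker-refl : ∀ a → kronecker a a ≡ 1ℤ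
kronecker-refl a = cong +_ (𝟙-yes (a ℕ.≟ a) refl)

kronecker-≢ : ∀ {a b} → a ≢ b → kronecker a b ≡ 0ℤ
kronecker-≢ {a} {b} a≢b = cong +_ (𝟙-no (a ℕ.≟ b) a≢b)

powerSum-range-kronecker-below : ∀ a n {i*} c x j → i* < a → powerSum (range a n) (λ i → kronecker i* i * c) x j ≡ 0ℤ
powerSum-range-kronecker-below a zero c x j i*<a = refl
powerSum-range-kronecker-below a (suc n) c x j i*<a =
  cong₂ (λ u v → u * c * x a ^ j + v) (kronecker-≢ (λ i*≡a → ℕP.<-irrefl i*≡a i*<a))
        (powerSum-range-kronecker-below (suc a) n c x j (ℕP.m<n⇒m<1+n i*<a))

powerSum-range-kronecker : ∀ a n {i*} c x j → a ≤ i* → i* < a ℕ.+ n →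
                           powerSum (range a n) (λ i → kronecker i* i * c) x j ≡ c * x i* ^ j
powerSum-range-kronecker a zero c x j a≤i* i*<a+0 = ⊥-elim (ℕP.<⇒≱ i*<a+0 (subst (_≤ _) (sym (ℕP.+-identityʳ a)) a≤i*))
powerSum-range-kronecker a (suc n) {i*} c x j a≤i* i*<a+n with ℕP.m≤n⇒m<n∨m≡n a≤i*
... | inj₂ refl = begin
      kronecker a a * c * x a ^ j + powerSum (range (suc a) n) (λ i → kronecker a i * c) x j
        ≡⟨ cong₂ (λ u v → u * c * x a ^ j + v) (kronecker-refl a) (powerSum-range-kronecker-below (suc a) n c x j (ℕP.n<1+n a)) ⟩
      1ℤ * c * x a ^ j + 0ℤ
        ≡⟨ trans (ℤP.+-identityʳ _) (cong (_* x a ^ j) (ℤP.*-identityˡ c)) ⟩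
      c * x a ^ j ∎
  where open ≡-Reasoning
... | inj₁ a<i* = begin
      kronecker i* a * c * x a ^ j + powerSum (range (suc a) n) (λ i → kronecker i* i * c) x j
        ≡⟨ cong₂ (λ u v → u * c * x a ^ j + v) (kronecker-≢ (λ i*≡a → ℕP.<-irrefl (sym i*≡a) a<i*))
             (powerSum-range-kronecker (suc a) n c x j a<i* (subst (i* <_) (ℕP.+-suc a n) i*<a+n)) ⟩
      0ℤ * c * x a ^ j + c * x i* ^ j
        ≡⟨ ℤP.+-identityˡ (c * x i* ^ j) ⟩
      c * x i* ^ j ∎
  where open ≡-Reasoning

extreme-index : ∀ {i m} → i ≤ m → m ℕ.! ≤ i ℕ.! ℕ.* (m ℕ.∸ i) ℕ.! → i ≡ 0 ⊎ i ≡ m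
extreme-index {zero} _ _ = inj₁ refl
extreme-index {suc i} {m} i<m m!≤ with suc i ℕ.≟ m
... | yes i+1≡m = inj₂ i+1≡m
... | no i+1≢m = ⊥-elim (ℕP.<⇒≱ (k![n∸k]!<n! (s≤s z≤n) (ℕP.≤∧≢⇒< i<m i+1≢m)) m!≤)

L∣ρ-t⇒t%L≡ρ : ∀ L .{{_ : NonZero L}} {ρ t} → ρ < L → (+ L) ∣ (+ ρ - + t) → t % L ≡ ρ
L∣ρ-t⇒t%L≡ρ L {ρ} {t} ρ<L L∣ρ-t with ℕP.≤-total ρ t
... | inj₁ ρ≤t with ℤ∣.∣⇒∣ᵤ L∣ρ-t
...   | ℕ∣.divides q ∣ρ-t∣≡q*L = begin
        t % L                     ≡⟨ cong (_% L) (sym (ℕP.m+[n∸m]≡n ρ≤t)) ⟩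
        (ρ ℕ.+ (t ℕ.∸ ρ)) % L     ≡⟨ cong (λ u → (ρ ℕ.+ u) % L) (trans (sym (∣m-n∣≡n∸m ρ≤t)) ∣ρ-t∣≡q*L) ⟩
        (ρ ℕ.+ q ℕ.* L) % L       ≡⟨ ℕDM.[m+kn]%n≡m%n ρ q L ⟩
        ρ % L                     ≡⟨ ℕDM.m<n⇒m%n≡m ρ<L ⟩
        ρ                         ∎
  where open ≡-Reasoning
L∣ρ-t⇒t%L≡ρ L {ρ} {t} ρ<L L∣ρ-t | inj₂ t≤ρ with t ℕ.≟ ρ
... | yes t≡ρ = trans (cong (_% L) t≡ρ) (ℕDM.m<n⇒m%n≡m ρ<L)
... | no t≢ρ = ⊥-elim (ℕP.<⇒≱ ρ<L (ℕP.≤-trans L≤ρ-t (ℕP.m∸n≤m ρ t)))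
  where
  L≤ρ-t : L ≤ ρ ℕ.∸ t
  L≤ρ-t = ℕ∣.∣⇒≤ {{ℕ.>-nonZero (ℕP.m<n⇒0<n∸m (ℕP.≤∧≢⇒< t≤ρ t≢ρ))}}
                 (subst (L ℕ∣.∣_) (∣m-n∣≡m∸n t≤ρ) (ℤ∣.∣⇒∣ᵤ L∣ρ-t))

≤-%-of-block : ∀ L .{{_ : NonZero L}} q {σ T} → q ℕ.* L ℕ.+ σ ≤ T → T < q ℕ.* L ℕ.+ L → σ ≤ T % L
≤-%-of-block L q {σ} {T} qL+σ≤T T<qL+L = subst (σ ≤_) (sym T%L≡R) σ≤R
  where
  R = T ℕ.∸ q ℕ.* L
  qL+R≡T : q ℕ.* L ℕ.+ R ≡ T
  qL+R≡T = ℕP.m+[n∸m]≡n (ℕP.≤-trans (ℕP.m≤m+n (q ℕ.* L) σ) qL+σ≤T)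
  σ≤R : σ ≤ R
  σ≤R = ℕP.+-cancelˡ-≤ (q ℕ.* L) σ R (subst (q ℕ.* L ℕ.+ σ ≤_) (sym qL+R≡T) qL+σ≤T)
  R<L : R < L
  R<L = ℕP.+-cancelˡ-< (q ℕ.* L) R L (subst (_< q ℕ.* L ℕ.+ L) (sym qL+R≡T) T<qL+L)
  T%L≡R : T % L ≡ R
  T%L≡R = begin
    T % L                 ≡⟨ cong (_% L) (trans (sym qL+R≡T) (ℕP.+-comm (q ℕ.* L) R)) ⟩
    (R ℕ.+ q ℕ.* L) % L   ≡⟨ ℕDM.[m+kn]%n≡m%n R q L ⟩
    R % L                 ≡⟨ ℕDM.m<n⇒m%n≡m R<L ⟩
    R                     ∎
    where open ≡-Reasoning

%-+-∸ : ∀ M .{{_ : NonZero M}} {a c} → a ≤ c → a % M ≤ c % M → a % M ℕ.+ (c ℕ.∸ a) % M ≡ c % M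
%-+-∸ M {a} {c} a≤c a%≤c% with (a % M ℕ.+ (c ℕ.∸ a) % M) ℕ.<? M
... | yes s<M = sym (trans (cong (_% M) (sym (ℕP.m+[n∸m]≡n a≤c))) (trans (ℕDM.%-distribˡ-+ a (c ℕ.∸ a) M) (ℕDM.m<n⇒m%n≡m s<M)))
... | no s≮M = ⊥-elim (ℕP.<⇒≱ c%<a% a%≤c%)
  where
  s = a % M ℕ.+ (c ℕ.∸ a) % M
  M≤s : M ≤ s
  M≤s = ℕP.≮⇒≥ s≮M
  c%≡s-M : c % M ≡ s ℕ.∸ M
  c%≡s-M = begin
      c % M                  ≡⟨ cong (_% M) (sym (ℕP.m+[n∸m]≡n a≤c)) ⟩
      (a ℕ.+ (c ℕ.∸ a)) % M  ≡⟨ ℕDM.%-distribˡ-+ a (c ℕ.∸ a) M ⟩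
      s % M                  ≡⟨ sym (ℕDM.m≤n⇒[n∸m]%m≡n%m M≤s) ⟩
      (s ℕ.∸ M) % M          ≡⟨ ℕDM.m<n⇒m%n≡m (ℕP.+-cancelˡ-< M (s ℕ.∸ M) M
                                  (subst (_< M ℕ.+ M) (sym (ℕP.m+[n∸m]≡n M≤s)) (ℕP.+-mono-< (ℕDM.m%n<n a M) (ℕDM.m%n<n (c ℕ.∸ a) M)))) ⟩
      s ℕ.∸ M                ∎
    where open ≡-Reasoning
  c%<a% : c % M < a % M
  c%<a% = subst (_< a % M) (sym c%≡s-M) (ℕP.+-cancelʳ-< M (s ℕ.∸ M) (a % M)
            (subst (_< a % M ℕ.+ M) (sym (ℕP.m∸n+n≡m M≤s)) (ℕP.+-monoʳ-< (a % M) (ℕDM.m%n<n (c ℕ.∸ a) M))))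

-- The covering argument

module CoveringArgument
  (k n₀ L′ : ℕ) {{n₀≢0 : NonZero n₀}} {{L′≢0 : NonZero L′}}
  (a₀ : ℤ) (a : Fin k → ℤ) (n e : Fin k → ℕ)
  (n∣⇒L∣ : ∀ s x → (+ n s) ∣ (x - a s) → (+ (n₀ ℕ.* L′)) ∣ ((x - a s) * + e s))
  where

  L : ℕ
  L = n₀ ℕ.* L′

  instance
    L≢0 : NonZero L
    L≢0 = ℕP.m*n≢0 n₀ L′

  open Sieve L

  E : Subset k → ℕ
  E I = subsetSumℕ I e

  Eₜₒₜ : ℕ
  Eₜₒₜ = E ⊤

  B : Subset k → ℤ
  B I = subsetSum I (λ s → a s * + e s)

  φ : ℤ → Fin k → ℤ
  φ x s = (x - a s) * + e s

  covered : ℤ → ℕ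
  covered x = count (λ s → (+ n s) ∣? (x - a s))

  L∣φ-count : ℤ → ℕ
  L∣φ-count x = count (λ s → (+ L) ∣? φ x s)

  covered≤L∣φ-count : ∀ x → covered x ≤ L∣φ-count x
  covered≤L∣φ-count x = count-mono _ _ (λ s → n∣⇒L∣ s x)

  localSum : ℕ → ℤ → ℤ → ℤ
  localSum j x c = altSum (λ I → sieve (c - subsetSum I (φ x)) * (+ E I) ^ j)

  localSum-vanishes : ∀ j x c → j < L∣φ-count x → localSum j x c ≡ 0ℤ
  localSum-vanishes j x c j<count = begin
      altSum (λ I → sieve (c - subsetSum I (φ x)) * (+ E I) ^ j)
        ≡⟨ altSum-cong (λ I → cong₂ (λ u v → sieve (c - u) * v ^ j) (sym (ℤP.+-identityˡ (subsetSum I (φ x))))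
                                                           (sym (trans (ℤP.+-identityˡ _) (subsetSum-pos I e)))) ⟩
      altSum (λ I → sieve (c - (0ℤ + subsetSum I (φ x))) * (0ℤ + subsetSum I (+_ ∘ e)) ^ j)
        ≡⟨ altSum-vanishes L (+_ ∘ e) (φ x) sieve-reflected-periodic {_^ j}
             (DegreeBelow-mono j<count (DegreeBelow-^ j)) 0ℤ 0ℤ ⟩
      0ℤ ∎
    where
    open ≡-Reasoning
    sieve-reflected-periodic : Periodic L (λ z → sieve (c - z))
    sieve-reflected-periodic z t L∣t =
      trans (cong sieve (solve 3 (λ c z t → c :- (z :+ t) := (c :- z) :+ :- t) refl c z t))
            (sieve-periodic (c - z) (- t) (ℤ∣.∣m⇒∣-m L∣t))

  sieveMoment : ℕ → ℤ → ℤ → ℤ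
  sieveMoment j ρ g = altSum (λ I → ind (ρ - + E I) * sieve (g + B I) * (+ E I) ^ j)

  sumBelow-localSum : ∀ j ρ g → sumBelow L (λ x → localSum j x (g + x * ρ)) ≡ + L * sieveMoment j ρ g
  sumBelow-localSum j ρ g = begin
      sumBelow L (λ x → altSum (λ I → sieve (g + x * ρ - subsetSum I (φ x)) * (+ E I) ^ j))
        ≡⟨ sumBelow-altSum L (λ x I → sieve (g + x * ρ - subsetSum I (φ x)) * (+ E I) ^ j) ⟩
      altSum (λ I → sumBelow L (λ x → sieve (g + x * ρ - subsetSum I (φ x)) * (+ E I) ^ j))
        ≡⟨ altSum-cong average ⟩
      altSum (λ I → + L * (ind (ρ - + E I) * sieve (g + B I) * (+ E I) ^ j))
        ≡⟨ altSum-*ˡ (+ L) (λ I → ind (ρ - + E I) * sieve (g + B I) * (+ E I) ^ j) ⟩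
      + L * sieveMoment j ρ g ∎
    where
    open ≡-Reasoning
    affine : ∀ I x → g + x * ρ - subsetSum I (φ x) ≡ (g + B I) + x * (ρ - + E I)
    affine I x = begin
      g + x * ρ - subsetSum I (φ x)
        ≡⟨ cong (λ t → g + x * ρ - t) (subsetSum-affine I x a (+_ ∘ e)) ⟩
      g + x * ρ - (x * subsetSum I (+_ ∘ e) - B I)
        ≡⟨ cong (λ t → g + x * ρ - (x * t - B I)) (subsetSum-pos I e) ⟩
      g + x * ρ - (x * + E I - B I)
        ≡⟨ solve 5 (λ g x ρ E B → g :+ x :* ρ :- (x :* E :- B) := (g :+ B) :+ x :* (ρ :- E)) refl g x ρ (+ E I) (B I) ⟩
      (g + B I) + x * (ρ - + E I) ∎
    average : ∀ I → sumBelow L (λ x → sieve (g + x * ρ - subsetSum I (φ x)) * (+ E I) ^ j)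
                  ≡ + L * (ind (ρ - + E I) * sieve (g + B I) * (+ E I) ^ j)
    average I = begin
      sumBelow L (λ x → sieve (g + x * ρ - subsetSum I (φ x)) * (+ E I) ^ j)
        ≡⟨ sumBelow-*ʳ L (λ x → sieve (g + x * ρ - subsetSum I (φ x))) ((+ E I) ^ j) ⟩
      sumBelow L (λ x → sieve (g + x * ρ - subsetSum I (φ x))) * (+ E I) ^ j
        ≡⟨ cong (_* (+ E I) ^ j) (sumBelow-cong L (λ x → cong sieve (affine I x))) ⟩
      sumBelow L (λ x → sieve ((g + B I) + x * (ρ - + E I))) * (+ E I) ^ j
        ≡⟨ cong (_* (+ E I) ^ j) (sumBelow-sieve-affine (g + B I) (ρ - + E I)) ⟩
      + L * (ind (ρ - + E I) * sieve (g + B I)) * (+ E I) ^ j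
        ≡⟨ ℤP.*-assoc (+ L) (ind (ρ - + E I) * sieve (g + B I)) ((+ E I) ^ j) ⟩
      + L * (ind (ρ - + E I) * sieve (g + B I) * (+ E I) ^ j) ∎

  weight : ℕ → ℤ → ℕ → ℤ
  weight ρ g i = altSum (λ I → kronecker (E I) (ρ ℕ.+ i ℕ.* L) * sieve (g + B I))

  node : ℕ → ℕ → ℤ
  node ρ i = + ρ + + i * + L

  weight≢0⇒≤Eₜₒₜ : ∀ ρ g i → weight ρ g i ≢ 0ℤ → ρ ℕ.+ i ℕ.* L ≤ Eₜₒₜ
  weight≢0⇒≤Eₜₒₜ ρ g i weight≢0 with (ρ ℕ.+ i ℕ.* L) ℕ.≤? Eₜₒₜ
  ... | yes ≤Eₜₒₜ = ≤Eₜₒₜ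
  ... | no ≰Eₜₒₜ = ⊥-elim (weight≢0 (altSum-zero (λ I →
          cong (_* sieve (g + B I)) (kronecker-≢ (λ EI≡ → ≰Eₜₒₜ (subst (_≤ Eₜₒₜ) EI≡ (subsetSumℕ-≤-⊤ I e)))))))

  module Covered (m : ℕ) (Eₜₒₜ<[1+m]L : Eₜₒₜ < suc m ℕ.* L)
                 (cover : ∀ x → m < 𝟙 ((+ n₀) ∣? (x - a₀)) ℕ.+ covered x) where

    m≤L∣φ-count : ∀ x → m ≤ L∣φ-count x
    m≤L∣φ-count x = ℕP.≤-trans (ℕP.≤-pred (ℕP.≤-trans (cover x) (ℕP.+-monoˡ-≤ (covered x) (𝟙≤1 ((+ n₀) ∣? (x - a₀))))))
                              (covered≤L∣φ-count x)

    m<L∣φ-count : ∀ x → ¬ (+ n₀) ∣ (x - a₀) → m < L∣φ-count x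
    m<L∣φ-count x n₀∤x-a₀ = ℕP.<-≤-trans (subst (m <_) (cong (ℕ._+ covered x) (𝟙-no ((+ n₀) ∣? (x - a₀)) n₀∤x-a₀)) (cover x))
                                         (covered≤L∣φ-count x)

    sieveMoment-below : ∀ j → j < m → ∀ ρ g → sieveMoment j ρ g ≡ 0ℤ
    sieveMoment-below j j<m ρ g = ℤP.*-cancelˡ-≡ (+ L) (sieveMoment j ρ g) 0ℤ (begin
      + L * sieveMoment j ρ g                    ≡⟨ sym (sumBelow-localSum j ρ g) ⟩
      sumBelow L (λ x → localSum j x (g + x * ρ)) ≡⟨ sumBelow-zero L (λ x → localSum-vanishes j x (g + x * ρ) (ℕP.<-≤-trans j<m (m≤L∣φ-count x))) ⟩
      0ℤ                                         ≡⟨ sym (ℤP.*-zeroʳ (+ L)) ⟩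
      + L * 0ℤ                                   ∎)
      where open ≡-Reasoning

    -- If n₀ ∣ x - a₀ the two arguments differ by (x - a₀) L′, a multiple of L; otherwise
    -- x is covered m + 1 times by the moduli n s and both sums vanish.
    localSum-top-shift : ∀ x ρ g → localSum m x (g + x * (ρ + + L′)) ≡ localSum m x (g + a₀ * + L′ + x * ρ)
    localSum-top-shift x ρ g with (+ n₀) ∣? (x - a₀)
    ... | yes (divides t x-a₀≡t*n₀) = altSum-cong (λ I → cong (_* (+ E I) ^ m)
          (trans (cong sieve (split (subsetSum I (φ x)))) (sieve-periodic (g + a₀ * + L′ + x * ρ - subsetSum I (φ x)) ((x - a₀) * + L′) L∣[x-a₀]L′)))
      where
      split : ∀ S → g + x * (ρ + + L′) - S ≡ (g + a₀ * + L′ + x * ρ - S) + (x - a₀) * + L′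
      split S = solve 6 (λ g x ρ l S a → g :+ x :* (ρ :+ l) :- S := (g :+ a :* l :+ x :* ρ :- S) :+ (x :- a) :* l) refl g x ρ (+ L′) S a₀
      L∣[x-a₀]L′ : (+ L) ∣ ((x - a₀) * + L′)
      L∣[x-a₀]L′ = divides t (trans (cong (_* + L′) x-a₀≡t*n₀) (trans (ℤP.*-assoc t (+ n₀) (+ L′)) (cong (t *_) (sym (ℤP.pos-* n₀ L′)))))
    ... | no n₀∤x-a₀ = trans (localSum-vanishes m x (g + x * (ρ + + L′)) (m<L∣φ-count x n₀∤x-a₀))
                         (sym (localSum-vanishes m x (g + a₀ * + L′ + x * ρ) (m<L∣φ-count x n₀∤x-a₀)))

    sieveMoment-top-shift : ∀ ρ g → sieveMoment m (ρ + + L′) g ≡ sieveMoment m ρ (g + a₀ * + L′)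
    sieveMoment-top-shift ρ g = ℤP.*-cancelˡ-≡ (+ L) _ _ (begin
      + L * sieveMoment m (ρ + + L′) g                       ≡⟨ sym (sumBelow-localSum m (ρ + + L′) g) ⟩
      sumBelow L (λ x → localSum m x (g + x * (ρ + + L′)))   ≡⟨ sumBelow-cong L (λ x → localSum-top-shift x ρ g) ⟩
      sumBelow L (λ x → localSum m x (g + a₀ * + L′ + x * ρ)) ≡⟨ sumBelow-localSum m ρ (g + a₀ * + L′) ⟩
      + L * sieveMoment m ρ (g + a₀ * + L′)                  ∎)
      where open ≡-Reasoning

    sieveMoment-top-shift-* : ∀ t ρ g → sieveMoment m (ρ + + t * + L′) g ≡ sieveMoment m ρ (g + + t * (a₀ * + L′))
    sieveMoment-top-shift-* zero ρ g = cong₂ (sieveMoment m) (ℤP.+-identityʳ ρ) (sym (ℤP.+-identityʳ g))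
    sieveMoment-top-shift-* (suc t) ρ g = begin
        sieveMoment m (ρ + + suc t * + L′) g
          ≡⟨ cong (λ u → sieveMoment m u g) (solve 3 (λ ρ t l → ρ :+ (con 1ℤ :+ t) :* l := (ρ :+ t :* l) :+ l) refl ρ (+ t) (+ L′)) ⟩
        sieveMoment m ((ρ + + t * + L′) + + L′) g
          ≡⟨ sieveMoment-top-shift (ρ + + t * + L′) g ⟩
        sieveMoment m (ρ + + t * + L′) (g + a₀ * + L′)
          ≡⟨ sieveMoment-top-shift-* t ρ (g + a₀ * + L′) ⟩
        sieveMoment m ρ (g + a₀ * + L′ + + t * (a₀ * + L′))
          ≡⟨ cong (sieveMoment m ρ) (solve 4 (λ g a l t → g :+ a :* l :+ t :* (a :* l) := g :+ (con 1ℤ :+ t) :* (a :* l)) refl g a₀ (+ L′) (+ t)) ⟩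
        sieveMoment m ρ (g + + suc t * (a₀ * + L′)) ∎
      where open ≡-Reasoning

    ≤Eₜₒₜ⇒/L≤m : ∀ {t} → t ≤ Eₜₒₜ → t ℕ./ L ≤ m
    ≤Eₜₒₜ⇒/L≤m t≤Eₜₒₜ = ℕP.<⇒≤pred (ℕDM.m<n*o⇒m/o<n (ℕP.≤-<-trans t≤Eₜₒₜ Eₜₒₜ<[1+m]L))

    ind-term-as-powerSum : ∀ {ρ} → ρ < L → ∀ {t} → t ≤ Eₜₒₜ → ∀ c j →
      ind (+ ρ - + t) * c * (+ t) ^ j ≡ powerSum (range 0 (suc m)) (λ i → kronecker t (ρ ℕ.+ i ℕ.* L) * c) (node ρ) j
    ind-term-as-powerSum {ρ} ρ<L {t} t≤Eₜₒₜ c j with t % L ℕ.≟ ρ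
    ... | yes t%L≡ρ = begin
          ind (+ ρ - + t) * c * (+ t) ^ j ≡⟨ cong (λ u → u * c * (+ t) ^ j) (ind-yes L∣ρ-t) ⟩
          1ℤ * c * (+ t) ^ j              ≡⟨ cong (_* (+ t) ^ j) (ℤP.*-identityˡ c) ⟩
          c * (+ t) ^ j                   ≡⟨ cong (λ u → c * u ^ j) t≡node ⟩
          c * node ρ i* ^ j               ≡⟨ sym (powerSum-range-kronecker 0 (suc m) c (node ρ) j z≤n (s≤s (≤Eₜₒₜ⇒/L≤m t≤Eₜₒₜ))) ⟩
          powerSum (range 0 (suc m)) (λ i → kronecker i* i * c) (node ρ) j
            ≡⟨ powerSum-cong (range 0 (suc m)) (node ρ) j (λ i → cong (_* c) (sym (same-kronecker i))) ⟩
          powerSum (range 0 (suc m)) (λ i → kronecker t (ρ ℕ.+ i ℕ.* L) * c) (node ρ) j ∎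
      where
      open ≡-Reasoning
      i* = t ℕ./ L
      t≡ρ+i*L : t ≡ ρ ℕ.+ i* ℕ.* L
      t≡ρ+i*L = trans (ℕDM.m≡m%n+[m/n]*n t L) (cong (ℕ._+ i* ℕ.* L) t%L≡ρ)
      t≡node : + t ≡ node ρ i*
      t≡node = trans (cong +_ t≡ρ+i*L) (trans (ℤP.pos-+ ρ (i* ℕ.* L)) (cong (_+_ (+ ρ)) (ℤP.pos-* i* L)))
      L∣ρ-t : (+ L) ∣ (+ ρ - + t)
      L∣ρ-t = divides (- + i*) (trans (cong (_-_ (+ ρ)) t≡node)
                (solve 3 (λ a b c → a :- (a :+ b :* c) := :- b :* c) refl (+ ρ) (+ i*) (+ L)))
      same-kronecker : ∀ i → kronecker t (ρ ℕ.+ i ℕ.* L) ≡ kronecker i* i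
      same-kronecker i with i* ℕ.≟ i
      ... | yes refl = trans (cong (λ u → kronecker u (ρ ℕ.+ i* ℕ.* L)) t≡ρ+i*L) (kronecker-refl (ρ ℕ.+ i* ℕ.* L))
      ... | no i*≢i = kronecker-≢ (λ t≡ρ+iL → i*≢i
              (ℕP.*-cancelʳ-≡ i* i L (ℕP.+-cancelˡ-≡ ρ (i* ℕ.* L) (i ℕ.* L) (trans (sym t≡ρ+i*L) t≡ρ+iL))))
    ... | no t%L≢ρ = begin
          ind (+ ρ - + t) * c * (+ t) ^ j ≡⟨ cong (λ u → u * c * (+ t) ^ j) (ind-no (t%L≢ρ ∘ L∣ρ-t⇒t%L≡ρ L ρ<L)) ⟩
          0ℤ                              ≡⟨ sym (powerSum-zero (range 0 (suc m)) (node ρ) j (λ i → cong (_* c) (kronecker-≢ (λ t≡ρ+iL →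
                                                t%L≢ρ (trans (cong (_% L) t≡ρ+iL) (trans (ℕDM.[m+kn]%n≡m%n ρ i L) (ℕDM.m<n⇒m%n≡m ρ<L))))))) ⟩
          powerSum (range 0 (suc m)) (λ i → kronecker t (ρ ℕ.+ i ℕ.* L) * c) (node ρ) j ∎
      where open ≡-Reasoning

    sieveMoment-as-powerSum : ∀ {ρ} → ρ < L → ∀ g j → sieveMoment j (+ ρ) g ≡ powerSum (range 0 (suc m)) (weight ρ g) (node ρ) j
    sieveMoment-as-powerSum {ρ} ρ<L g j = begin
        altSum (λ I → ind (+ ρ - + E I) * sieve (g + B I) * (+ E I) ^ j)
          ≡⟨ altSum-cong (λ I → ind-term-as-powerSum ρ<L (subsetSumℕ-≤-⊤ I e) (sieve (g + B I)) j) ⟩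
        altSum (λ I → powerSum (range 0 (suc m)) (λ i → kronecker (E I) (ρ ℕ.+ i ℕ.* L) * sieve (g + B I)) (node ρ) j)
          ≡⟨ sym (powerSum-altSum (range 0 (suc m)) (λ i I → kronecker (E I) (ρ ℕ.+ i ℕ.* L) * sieve (g + B I)) (node ρ) j) ⟩
        powerSum (range 0 (suc m)) (weight ρ g) (node ρ) j ∎
      where open ≡-Reasoning

    sieveMoment-top : ∀ {ρ} → ρ < L → ∀ g {i₀} → i₀ ≤ m →
                      sieveMoment m (+ ρ) g ≡ weight ρ g i₀ * prodDiff (node ρ i₀) (range-without m i₀) (node ρ)
    sieveMoment-top {ρ} ρ<L g {i₀} i₀≤m = trans (sieveMoment-as-powerSum ρ<L g m)
      (powerSum-range-vandermonde m i₀ i₀≤m (weight ρ g) (node ρ)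
        (λ j j<m → trans (sym (sieveMoment-as-powerSum ρ<L g j)) (sieveMoment-below j j<m (+ ρ) g)))

    ∣sieveMoment-top∣ : ∀ {ρ} → ρ < L → ∀ g {i₀} → i₀ ≤ m →
                        ℤ.∣ sieveMoment m (+ ρ) g ∣ ≡ ℤ.∣ weight ρ g i₀ ∣ ℕ.* (L ℕ.^ m ℕ.* (i₀ ℕ.! ℕ.* (m ℕ.∸ i₀) ℕ.!))
    ∣sieveMoment-top∣ {ρ} ρ<L g {i₀} i₀≤m = trans (cong ℤ.∣_∣ (sieveMoment-top ρ<L g i₀≤m))
      (trans (ℤP.abs-* (weight ρ g i₀) _) (cong (ℤ.∣ weight ρ g i₀ ∣ ℕ.*_) (∣prodDiff-progression∣ (+ ρ) L m i₀ i₀≤m)))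

    module UniqueSum (J : Subset k) (J-unique : ∀ I → E I ≡ E J → I ≡ J) where

      ρJ : ℕ
      ρJ = E J % L

      iJ : ℕ
      iJ = E J ℕ./ L

      ρJ<L : ρJ < L
      ρJ<L = ℕDM.m%n<n (E J) L

      EJ≡ρJ+iJL : E J ≡ ρJ ℕ.+ iJ ℕ.* L
      EJ≡ρJ+iJL = ℕDM.m≡m%n+[m/n]*n (E J) L

      iJ≤m : iJ ≤ m
      iJ≤m = ≤Eₜₒₜ⇒/L≤m (subsetSumℕ-≤-⊤ J e)

      ∣weight-J∣ : ℤ.∣ weight ρJ (- B J) iJ ∣ ≡ 1
      ∣weight-J∣ = begin
          ℤ.∣ weight ρJ (- B J) iJ ∣
            ≡⟨ ∣altSum∣-single J (λ I I≢J → cong (_* sieve (- B J + B I))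
                 (kronecker-≢ (λ EI≡ρJ+iJL → I≢J (J-unique I (trans EI≡ρJ+iJL (sym EJ≡ρJ+iJL)))))) ⟩
          ℤ.∣ kronecker (E J) (ρJ ℕ.+ iJ ℕ.* L) * sieve (- B J + B J) ∣
            ≡⟨ cong₂ (λ u v → ℤ.∣ u * sieve v ∣) (trans (cong (kronecker (E J)) (sym EJ≡ρJ+iJL)) (kronecker-refl (E J))) (ℤP.+-inverseˡ (B J)) ⟩
          ℤ.∣ 1ℤ * sieve 0ℤ ∣
            ≡⟨ cong (λ u → ℤ.∣ 1ℤ * u ∣) sieve-0 ⟩
          1 ∎
        where open ≡-Reasoning

      Y : ℤ
      Y = sieveMoment m (+ ρJ) (- B J)

      ∣Y∣ : ℤ.∣ Y ∣ ≡ L ℕ.^ m ℕ.* (iJ ℕ.! ℕ.* (m ℕ.∸ iJ) ℕ.!)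
      ∣Y∣ = trans (∣sieveMoment-top∣ ρJ<L (- B J) iJ≤m)
                  (trans (cong (ℕ._* (L ℕ.^ m ℕ.* (iJ ℕ.! ℕ.* (m ℕ.∸ iJ) ℕ.!))) ∣weight-J∣) (ℕP.*-identityˡ _))

      ∣Y∣≢0 : NonZero (L ℕ.^ m ℕ.* (iJ ℕ.! ℕ.* (m ℕ.∸ iJ) ℕ.!))
      ∣Y∣≢0 = ℕP.m*n≢0 _ _ {{ℕP.m^n≢0 L m}} {{ℕP._!*_!≢0 iJ (m ℕ.∸ iJ)}}

      Y≢0 : Y ≢ 0ℤ
      Y≢0 Y≡0 = ℕ.≢-nonZero⁻¹ _ {{∣Y∣≢0}} (trans (sym ∣Y∣) (cong ℤ.∣_∣ Y≡0))

      -- Comparing the two evaluations i₀ = iJ and i₀ = m of the top moment gives m! ≤ iJ! (m - iJ)!.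
      iJ-extreme : iJ ≡ 0 ⊎ iJ ≡ m
      iJ-extreme = extreme-index iJ≤m m!≤iJ![m-iJ]!
        where
        w = ℤ.∣ weight ρJ (- B J) m ∣
        Bₘ = L ℕ.^ m ℕ.* (m ℕ.! ℕ.* (m ℕ.∸ m) ℕ.!)
        Y≡w*Bₘ : L ℕ.^ m ℕ.* (iJ ℕ.! ℕ.* (m ℕ.∸ iJ) ℕ.!) ≡ w ℕ.* Bₘ
        Y≡w*Bₘ = trans (sym ∣Y∣) (∣sieveMoment-top∣ ρJ<L (- B J) ℕP.≤-refl)
        w≢0 : w ≢ 0
        w≢0 w≡0 = ℕ.≢-nonZero⁻¹ _ {{∣Y∣≢0}} (trans Y≡w*Bₘ (cong (ℕ._* Bₘ) w≡0))
        m!≤iJ![m-iJ]! : m ℕ.! ≤ iJ ℕ.! ℕ.* (m ℕ.∸ iJ) ℕ.!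
        m!≤iJ![m-iJ]! = subst (_≤ iJ ℕ.! ℕ.* (m ℕ.∸ iJ) ℕ.!) (trans (cong (λ u → m ℕ.! ℕ.* u ℕ.!) (ℕP.n∸n≡0 m)) (ℕP.*-identityʳ (m ℕ.!)))
          (ℕP.*-cancelˡ-≤ {m ℕ.! ℕ.* (m ℕ.∸ m) ℕ.!} {iJ ℕ.! ℕ.* (m ℕ.∸ iJ) ℕ.!} (L ℕ.^ m) {{ℕP.m^n≢0 L m}}
            (subst (Bₘ ≤_) (sym Y≡w*Bₘ) (ℕP.m≤n*m Bₘ w {{ℕ.≢-nonZero w≢0}})))

      p : ℕ
      p = ℕ.pred n₀

      n₀≡1+p : n₀ ≡ suc p
      n₀≡1+p = sym (ℕP.suc-pred n₀)

      σ : ℕ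
      σ = E J % L′

      ρJ≡σ+uL′ : ρJ ≡ σ ℕ.+ (ρJ ℕ./ L′) ℕ.* L′
      ρJ≡σ+uL′ = trans (ℕDM.m≡m%n+[m/n]*n ρJ L′) (cong (ℕ._+ (ρJ ℕ./ L′) ℕ.* L′) (ℕDM.m∣n⇒o%n%m≡o%m L′ L (E J) (ℕ∣.divides n₀ refl)))

      t : ℕ
      t = p ℕ.∸ ρJ ℕ./ L′

      ρₘₐₓ : ℕ
      ρₘₐₓ = ρJ ℕ.+ t ℕ.* L′

      ρₘₐₓ≡σ+pL′ : ρₘₐₓ ≡ σ ℕ.+ p ℕ.* L′
      ρₘₐₓ≡σ+pL′ = begin
          ρJ ℕ.+ t ℕ.* L′                            ≡⟨ cong (ℕ._+ t ℕ.* L′) ρJ≡σ+uL′ ⟩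
          σ ℕ.+ (ρJ ℕ./ L′) ℕ.* L′ ℕ.+ t ℕ.* L′      ≡⟨ regroup σ (ρJ ℕ./ L′) t L′ ⟩
          σ ℕ.+ ((ρJ ℕ./ L′) ℕ.+ t) ℕ.* L′           ≡⟨ cong (λ u → σ ℕ.+ u ℕ.* L′) (ℕP.m+[n∸m]≡n u≤p) ⟩
          σ ℕ.+ p ℕ.* L′                             ∎
        where
        open ≡-Reasoning
        regroup : ∀ σ u t l → σ ℕ.+ u ℕ.* l ℕ.+ t ℕ.* l ≡ σ ℕ.+ (u ℕ.+ t) ℕ.* l
        regroup = ℕRing.solve-∀
        u≤p : ρJ ℕ./ L′ ≤ p
        u≤p = ℕP.<⇒≤pred (ℕDM.m<n*o⇒m/o<n {ρJ} {n₀} {L′} ρJ<L)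

      ρₘₐₓ<L : ρₘₐₓ < L
      ρₘₐₓ<L = subst₂ _<_ (sym ρₘₐₓ≡σ+pL′) (cong (ℕ._* L′) (sym n₀≡1+p)) (ℕP.+-monoˡ-< (p ℕ.* L′) (ℕDM.m%n<n (E J) L′))

      -- Shifting ρJ up by t L′ does not change the top moment, so the highest node
      -- ρₘₐₓ + m L still carries a nonzero weight, i.e. it is the sum of some E I.
      ρₘₐₓ+mL≤Eₜₒₜ : ρₘₐₓ ℕ.+ m ℕ.* L ≤ Eₜₒₜ
      ρₘₐₓ+mL≤Eₜₒₜ = weight≢0⇒≤Eₜₒₜ ρₘₐₓ g m (λ weight≡0 → Y≢0 (begin
          Y                                               ≡⟨ cong (sieveMoment m (+ ρJ)) (solve 2 (λ g c → g := (g :- c) :+ c) refl (- B J) (+ t * (a₀ * + L′))) ⟩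
          sieveMoment m (+ ρJ) (g + + t * (a₀ * + L′))     ≡⟨ sym (sieveMoment-top-shift-* t (+ ρJ) g) ⟩
          sieveMoment m (+ ρJ + + t * + L′) g             ≡⟨ cong (λ u → sieveMoment m u g)
                                                               (trans (cong (_+_ (+ ρJ)) (sym (ℤP.pos-* t L′))) (sym (ℤP.pos-+ ρJ (t ℕ.* L′)))) ⟩
          sieveMoment m (+ ρₘₐₓ) g                        ≡⟨ sieveMoment-top ρₘₐₓ<L g ℕP.≤-refl ⟩
          weight ρₘₐₓ g m * prodDiff (node ρₘₐₓ m) (range-without m m) (node ρₘₐₓ)
                                                          ≡⟨ cong (_* prodDiff (node ρₘₐₓ m) (range-without m m) (node ρₘₐₓ)) weight≡0 ⟩
          0ℤ                                              ∎))
        where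
        open ≡-Reasoning
        g = - B J - + t * (a₀ * + L′)

      EJ%L′≤Eₜₒₜ%L′ : E J % L′ ≤ Eₜₒₜ % L′
      EJ%L′≤Eₜₒₜ%L′ = ≤-%-of-block L′ q
        (subst (_≤ Eₜₒₜ) (sym qL′+σ≡ρₘₐₓ+mL) ρₘₐₓ+mL≤Eₜₒₜ)
        (subst (Eₜₒₜ <_) qL′+L′≡[1+m]L Eₜₒₜ<[1+m]L)
        where
        q = p ℕ.+ m ℕ.* n₀
        identity₁ : ∀ p m L′ σ → (p ℕ.+ m ℕ.* suc p) ℕ.* L′ ℕ.+ σ ≡ (σ ℕ.+ p ℕ.* L′) ℕ.+ m ℕ.* (suc p ℕ.* L′)
        identity₁ = ℕRing.solve-∀
        identity₂ : ∀ p m L′ → (p ℕ.+ m ℕ.* suc p) ℕ.* L′ ℕ.+ L′ ≡ suc m ℕ.* (suc p ℕ.* L′)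
        identity₂ = ℕRing.solve-∀
        qL′+σ≡ρₘₐₓ+mL : q ℕ.* L′ ℕ.+ σ ≡ ρₘₐₓ ℕ.+ m ℕ.* L
        qL′+σ≡ρₘₐₓ+mL = trans
          (subst (λ N → (p ℕ.+ m ℕ.* N) ℕ.* L′ ℕ.+ σ ≡ (σ ℕ.+ p ℕ.* L′) ℕ.+ m ℕ.* (N ℕ.* L′)) (sym n₀≡1+p) (identity₁ p m L′ σ))
          (cong (ℕ._+ m ℕ.* L) (sym ρₘₐₓ≡σ+pL′))
        qL′+L′≡[1+m]L : suc m ℕ.* L ≡ q ℕ.* L′ ℕ.+ L′
        qL′+L′≡[1+m]L = sym (subst (λ N → (p ℕ.+ m ℕ.* N) ℕ.* L′ ℕ.+ L′ ≡ suc m ℕ.* (N ℕ.* L′)) (sym n₀≡1+p) (identity₂ p m L′))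

      iJ≡m⇒mL≤EJ : iJ ≡ m → m ℕ.* L ≤ E J
      iJ≡m⇒mL≤EJ iJ≡m = subst (_≤ E J) (cong (ℕ._* L) iJ≡m) (subst (iJ ℕ.* L ≤_) (sym EJ≡ρJ+iJL) (ℕP.m≤n+m (iJ ℕ.* L) ρJ))

      iJ≡0⇒mL≤Eₜₒₜ∸EJ : iJ ≡ 0 → m ℕ.* L ≤ Eₜₒₜ ℕ.∸ E J
      iJ≡0⇒mL≤Eₜₒₜ∸EJ iJ≡0 = ℕP.≤-trans mL≤Eₜₒₜ∸ρₘₐₓ (ℕP.∸-monoʳ-≤ Eₜₒₜ EJ≤ρₘₐₓ)
        where
        mL≤Eₜₒₜ∸ρₘₐₓ : m ℕ.* L ≤ Eₜₒₜ ℕ.∸ ρₘₐₓ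
        mL≤Eₜₒₜ∸ρₘₐₓ = ℕP.m+n≤o⇒m≤o∸n (m ℕ.* L) (subst (_≤ Eₜₒₜ) (ℕP.+-comm ρₘₐₓ (m ℕ.* L)) ρₘₐₓ+mL≤Eₜₒₜ)
        EJ≡ρJ : E J ≡ ρJ
        EJ≡ρJ = trans EJ≡ρJ+iJL (trans (cong (λ u → ρJ ℕ.+ u ℕ.* L) iJ≡0) (ℕP.+-identityʳ ρJ))
        EJ≤ρₘₐₓ : E J ≤ ρₘₐₓ
        EJ≤ρₘₐₓ = subst (_≤ ρₘₐₓ) (sym EJ≡ρJ) (ℕP.m≤m+n ρJ (t ℕ.* L′))

      mL≤EJ⊎mL≤Eₜₒₜ∸EJ : m ℕ.* L ≤ E J ⊎ m ℕ.* L ≤ Eₜₒₜ ℕ.∸ E J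
      mL≤EJ⊎mL≤Eₜₒₜ∸EJ = Sum.swap (Sum.map iJ≡0⇒mL≤Eₜₒₜ∸EJ iJ≡m⇒mL≤EJ iJ-extreme)

-- Rational arithmetic

toℚᵘ-/ : ∀ i n .{{_ : NonZero n}} → ℚ.toℚᵘ (i ℚ./ n) ℚᵘ.≃ mkℚᵘ i (ℕ.pred n)
toℚᵘ-/ i (suc n) = ℚP.toℚᵘ-fromℚᵘ (mkℚᵘ i n)

/-≡-cross : ∀ i j c d .{{_ : NonZero c}} .{{_ : NonZero d}} → i * + d ≡ j * + c → i ℚ./ c ≡ j ℚ./ d
/-≡-cross i j (suc c) (suc d) id≡jc = ℚP.toℚᵘ-injective
  (ℚᵘP.≃-trans (toℚᵘ-/ i (suc c)) (ℚᵘP.≃-trans (ℚᵘ.*≡* id≡jc) (ℚᵘP.≃-sym (toℚᵘ-/ j (suc d)))))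

/-+-distrib : ∀ a b L .{{_ : NonZero L}} → (+ a) ℚ./ L ℚ.+ (+ b) ℚ./ L ≡ (+ (a ℕ.+ b)) ℚ./ L
/-+-distrib a b (suc l) = ℚP.toℚᵘ-injective (ℚᵘP.≃-trans (ℚP.toℚᵘ-homo-+ ((+ a) ℚ./ suc l) ((+ b) ℚ./ suc l))
  (ℚᵘP.≃-trans (ℚᵘP.+-cong (toℚᵘ-/ (+ a) (suc l)) (toℚᵘ-/ (+ b) (suc l))) (ℚᵘP.≃-trans sum≃ (ℚᵘP.≃-sym (toℚᵘ-/ (+ (a ℕ.+ b)) (suc l))))))
  where
  sum≃ : mkℚᵘ (+ a) l ℚᵘ.+ mkℚᵘ (+ b) l ℚᵘ.≃ mkℚᵘ (+ (a ℕ.+ b)) l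
  sum≃ = ℚᵘ.*≡* (trans (solve 3 (λ a b s → (a :* s :+ b :* s) :* s := (a :+ b) :* (s :* s)) refl (+ a) (+ b) (+ suc l))
                       (cong (_* (+ suc l * + suc l)) (sym (ℤP.pos-+ a b))))

sumOver-/ : ∀ {k} (I : Subset k) (f : Fin k → ℚ) (v : Fin k → ℕ) L .{{_ : NonZero L}} →
            (∀ i → f i ≡ (+ v i) ℚ./ L) → sumOver I f ≡ (+ subsetSumℕ I v) ℚ./ L
sumOver-/ [] f v L f≡v/L = /-≡-cross 0ℤ 0ℤ 1 L refl
sumOver-/ (outside ∷ I) f v L f≡v/L = sumOver-/ I (f ∘ suc) (v ∘ suc) L (f≡v/L ∘ suc)
sumOver-/ (inside ∷ I) f v L f≡v/L = trans (cong₂ ℚ._+_ (f≡v/L zero) (sumOver-/ I (f ∘ suc) (v ∘ suc) L (f≡v/L ∘ suc)))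
  (/-+-distrib (v zero) (subsetSumℕ I (v ∘ suc)) L)

floor-/ : ∀ A L .{{_ : NonZero L}} → floor ((+ A) ℚ./ L) ≡ + (A ℕ./ L)
floor-/ A L = begin
    floor q                     ≡⟨ floor-def q ⟩
    ↥ q ℤ./ ↧ q                 ≡⟨ cong (ℤ._/ ↧ q) ↥q≡a ⟩
    (+ a) ℤ./ (+ b)             ≡⟨ ℤDM.div-pos-is-/ℕ (+ a) b ⟩
    + (a ℕ./ b)                 ≡⟨ cong +_ (sym (ℕDM.m*n/o*n≡m/o a g b)) ⟩
    + ((a ℕ.* g) ℕ./ (b ℕ.* g)) ≡⟨ cong +_ (trans (cong (ℕ._/ (b ℕ.* g)) a*g≡A) (ℕDM./-congʳ {m = A} b*g≡L)) ⟩
    + (A ℕ./ L)                 ∎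
  where
  open ≡-Reasoning
  q = (+ A) ℚ./ L
  floor-def : ∀ p → floor p ≡ ↥ p ℤ./ ↧ p
  floor-def (ℚ.mkℚ _ _ _) = refl
  g = gcd A L
  instance
    g≢0 : NonZero g
    g≢0 = ℕ.≢-nonZero (gcd[m,n]≢0 A L (inj₂ (ℕ.≢-nonZero⁻¹ L)))
  b = ↧ₙ q
  b*g≡L : b ℕ.* g ≡ L
  b*g≡L = ℤP.+-injective (trans (ℤP.pos-* b g) (ℚP.↧-/ (+ A) L))
  a = ℤ.∣ ↥ q ∣
  ↥q≡a : ↥ q ≡ + a
  ↥q≡a = nonNegative (↥ q) (trans (cong (λ h → ↥ q * + h) (ℕP.suc-pred g)) (ℚP.↥-/ (+ A) L))
    where
    nonNegative : ∀ {h} z → z * + suc h ≡ + A → z ≡ + ℤ.∣ z ∣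
    nonNegative (+ _) _ = refl
    nonNegative ℤ.-[1+ _ ] ()
  a*g≡A : a ℕ.* g ≡ A
  a*g≡A = ℤP.+-injective (trans (ℤP.pos-* a g) (trans (cong (_* + g) (sym ↥q≡a)) (ℚP.↥-/ (+ A) L)))
  instance
    b≢0 : NonZero b
    b≢0 = ℕ.≢-nonZero (λ b≡0 → ℕ.≢-nonZero⁻¹ L (trans (sym b*g≡L) (cong (ℕ._* g) b≡0)))
    b*g≢0 : NonZero (b ℕ.* g)
    b*g≢0 = ℕP.m*n≢0 b g

frac-/ : ∀ A L .{{_ : NonZero L}} → frac ((+ A) ℚ./ L) ≡ (+ (A % L)) ℚ./ L
frac-/ A (suc l) = trans (cong (λ t → q ℚ.- (t ℚ./ 1)) (floor-/ A (suc l)))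
  (ℚP.toℚᵘ-injective (ℚᵘP.≃-trans (ℚP.toℚᵘ-homo-+ q (ℚ.- ((+ d) ℚ./ 1)))
    (ℚᵘP.≃-trans (ℚᵘP.+-cong (toℚᵘ-/ (+ A) (suc l)) (ℚᵘP.≃-trans (ℚP.toℚᵘ-homo‿- ((+ d) ℚ./ 1)) (ℚᵘP.-‿cong (toℚᵘ-/ (+ d) 1))))
      (ℚᵘP.≃-trans difference≃ (ℚᵘP.≃-sym (toℚᵘ-/ (+ r) (suc l)))))))
  where
  q = (+ A) ℚ./ suc l
  d = A ℕ./ suc l
  r = A % suc l
  s = + suc l
  A≡r+ds : + A ≡ + r + + d * s
  A≡r+ds = trans (cong +_ (ℕDM.m≡m%n+[m/n]*n A (suc l))) (trans (ℤP.pos-+ r (d ℕ.* suc l)) (cong (_+_ (+ r)) (ℤP.pos-* d (suc l))))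
  difference≃ : mkℚᵘ (+ A) l ℚᵘ.+ ℚᵘ.- mkℚᵘ (+ d) 0 ℚᵘ.≃ mkℚᵘ (+ r) l
  difference≃ = ℚᵘ.*≡* (begin
      (+ A * + 1 + (- + d) * s) * s             ≡⟨ cong (λ t → (t * + 1 + (- + d) * s) * s) A≡r+ds ⟩
      ((+ r + + d * s) * + 1 + (- + d) * s) * s ≡⟨ solve 3 (λ r d s → ((r :+ d :* s) :* con (+ 1) :+ (:- d) :* s) :* s := r :* (s :* con (+ 1))) refl (+ r) (+ d) s ⟩
      + r * (s * + 1)                           ≡⟨ cong (_*_ (+ r)) (sym (ℤP.pos-* (suc l) 1)) ⟩
      + r * + (suc l ℕ.* 1)                     ∎)
    where open ≡-Reasoning

*-/-cancelˡ : ∀ A c L .{{_ : NonZero c}} .{{_ : NonZero L}} .{{_ : NonZero (c ℕ.* L)}} →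
              ((+ c) ℚ./ 1) ℚ.* ((+ A) ℚ./ (c ℕ.* L)) ≡ (+ A) ℚ./ L
*-/-cancelˡ A (suc c) (suc l) = ℚP.toℚᵘ-injective (ℚᵘP.≃-trans (ℚP.toℚᵘ-homo-* ((+ suc c) ℚ./ 1) ((+ A) ℚ./ (suc c ℕ.* suc l)))
  (ℚᵘP.≃-trans (ℚᵘP.*-cong (toℚᵘ-/ (+ suc c) 1) (toℚᵘ-/ (+ A) (suc c ℕ.* suc l))) (ℚᵘP.≃-trans product≃ (ℚᵘP.≃-sym (toℚᵘ-/ (+ A) (suc l))))))
  where
  product≃ : mkℚᵘ (+ suc c) 0 ℚᵘ.* mkℚᵘ (+ A) (ℕ.pred (suc c ℕ.* suc l)) ℚᵘ.≃ mkℚᵘ (+ A) l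
  product≃ = ℚᵘ.*≡* (begin
      (+ suc c * + A) * + suc l            ≡⟨ solve 3 (λ x y z → (x :* y) :* z := y :* (con (+ 1) :* (x :* z))) refl (+ suc c) (+ A) (+ suc l) ⟩
      + A * (+ 1 * (+ suc c * + suc l))    ≡⟨ cong (λ t → + A * (+ 1 * t)) (sym (ℤP.pos-* (suc c) (suc l))) ⟩
      + A * (+ 1 * + (suc c ℕ.* suc l))    ≡⟨ cong (_*_ (+ A)) (sym (ℤP.pos-* 1 (suc c ℕ.* suc l))) ⟩
      + A * + (1 ℕ.* (suc c ℕ.* suc l))    ∎)
    where open ≡-Reasoning

/-<-1 : ∀ {c L} .{{_ : NonZero L}} → c < L → (+ c) ℚ./ L ℚ.< ℚ.1ℚ
/-<-1 {c} {suc l} c<L = ℚP.toℚᵘ-cancel-< (ℚᵘP.<-respˡ-≃ (ℚᵘP.≃-sym (toℚᵘ-/ (+ c) (suc l))) (ℚᵘP.<-respʳ-≃ (ℚᵘP.≃-sym (toℚᵘ-/ 1ℤ 1))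
  (ℚᵘ.*<* (subst₂ ℤ._<_ (ℤP.pos-* c 1) (ℤP.pos-* 1 (suc l)) (ℤ.+<+ (subst₂ _<_ (sym (ℕP.*-identityʳ c)) (sym (ℕP.*-identityˡ (suc l))) c<L))))))

/1-≤-/ : ∀ {m A L} .{{_ : NonZero L}} → m ℕ.* L ≤ A → (+ m) ℚ./ 1 ℚ.≤ (+ A) ℚ./ L
/1-≤-/ {m} {A} {suc l} mL≤A = ℚP.toℚᵘ-cancel-≤ (ℚᵘP.≤-respˡ-≃ (ℚᵘP.≃-sym (toℚᵘ-/ (+ m) 1)) (ℚᵘP.≤-respʳ-≃ (ℚᵘP.≃-sym (toℚᵘ-/ (+ A) (suc l)))
  (ℚᵘ.*≤* (subst₂ ℤ._≤_ (ℤP.pos-* m (suc l)) (ℤP.pos-* A 1) (ℤ.+≤+ (subst (m ℕ.* suc l ≤_) (sym (ℕP.*-identityʳ A)) mL≤A))))))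

module IntegerForm (k : ℕ) (a : Fin (suc k) → ℤ) (n : Fin (suc k) → ℕ) (npos : ∀ s → 0 < n s) (ms : Fin k → ℕ) where

  n₀ : ℕ
  n₀ = n zero

  nₛ : Fin k → ℕ
  nₛ = n ∘ suc

  nₛ≢0 : ∀ s → NonZero (nₛ s)
  nₛ≢0 s = ℕ.>-nonZero (npos (suc s))

  L′ : ℕ
  L′ = product (tabulate nₛ)

  instance
    n₀≢0 : NonZero n₀
    n₀≢0 = ℕ.>-nonZero (npos zero)
    L′≢0 : NonZero L′
    L′≢0 = product≢0 (AllP.tabulate⁺ nₛ≢0)

  nₛ∣n₀L′ : ∀ s → nₛ s ℕ∣.∣ n₀ ℕ.* L′
  nₛ∣n₀L′ s = ℕ∣.∣n⇒∣m*n n₀ (∈⇒∣product (∈-tabulate⁺ s))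

  -- ms s / nₛ s = e s / L with L = n₀ L′
  e : Fin k → ℕ
  e s = ms s ℕ.* (n₀ ℕ.* L′ ℕ./ nₛ s) {{nₛ≢0 s}}

  e*nₛ≡ms*L : ∀ s → e s ℕ.* nₛ s ≡ ms s ℕ.* (n₀ ℕ.* L′)
  e*nₛ≡ms*L s = trans (ℕP.*-assoc (ms s) _ (nₛ s))
    (cong (ms s ℕ.*_) (trans (ℕP.*-comm _ (nₛ s)) (ℕDM.m*[n/m]≡n {{nₛ≢0 s}} (nₛ∣n₀L′ s))))

  n∣⇒L∣ : ∀ s x → (+ nₛ s) ∣ (x - a (suc s)) → (+ (n₀ ℕ.* L′)) ∣ ((x - a (suc s)) * + e s)
  n∣⇒L∣ s x (divides q x-a≡q*n) = divides (q * + ms s) (begin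
      (x - a (suc s)) * + e s       ≡⟨ cong (_* + e s) x-a≡q*n ⟩
      q * + nₛ s * + e s            ≡⟨ solve 3 (λ q a b → q :* a :* b := q :* (b :* a)) refl q (+ nₛ s) (+ e s) ⟩
      q * (+ e s * + nₛ s)          ≡⟨ cong (q *_) (trans (sym (ℤP.pos-* (e s) (nₛ s))) (trans (cong +_ (e*nₛ≡ms*L s)) (ℤP.pos-* (ms s) _))) ⟩
      q * (+ ms s * + (n₀ ℕ.* L′))  ≡⟨ sym (ℤP.*-assoc q (+ ms s) _) ⟩
      q * + ms s * + (n₀ ℕ.* L′)    ∎)
    where open ≡-Reasoning

  open CoveringArgument k n₀ L′ (a zero) (a ∘ suc) nₛ e n∣⇒L∣ public

  w : Fin k → ℚ
  w i = ratio (ms i) (n (suc i)) (npos (suc i))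

  sumOver-w : ∀ I → sumOver I w ≡ (+ E I) ℚ./ L
  sumOver-w I = sumOver-/ I w e L (λ i → /-≡-cross (+ ms i) (+ e i) (nₛ i) L {{nₛ≢0 i}}
    (trans (sym (ℤP.pos-* (ms i) L)) (trans (cong +_ (sym (e*nₛ≡ms*L i))) (ℤP.pos-* (e i) (nₛ i)))))

  floor-sumOver-w : floor (sumOver ⊤ w) ≡ + (Eₜₒₜ ℕ./ L)
  floor-sumOver-w = trans (cong floor (sumOver-w ⊤)) (floor-/ Eₜₒₜ L)

  Eₜₒₜ<[1+m]L : Eₜₒₜ < suc (Eₜₒₜ ℕ./ L) ℕ.* L
  Eₜₒₜ<[1+m]L = begin-strict
      Eₜₒₜ                                   ≡⟨ ℕDM.m≡m%n+[m/n]*n Eₜₒₜ L ⟩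
      Eₜₒₜ % L ℕ.+ (Eₜₒₜ ℕ./ L) ℕ.* L        <⟨ ℕP.+-monoˡ-< _ (ℕDM.m%n<n Eₜₒₜ L) ⟩
      L ℕ.+ (Eₜₒₜ ℕ./ L) ℕ.* L               ∎
    where open ℕP.≤-Reasoning

  cover-ℕ : (∀ x → floor (sumOver ⊤ w) ℤ.< + coverCount a n x) →
            ∀ x → Eₜₒₜ ℕ./ L < 𝟙 ((+ n₀) ∣? (x - a zero)) ℕ.+ covered x
  cover-ℕ cover x = ℤP.drop‿+<+ (subst₂ ℤ._<_ floor-sumOver-w
    (cong +_ (length-filter-tabulate (λ s → (+ n s) ∣? (x - a s)) (λ s → s))) (cover x))

  E-unique : ∀ J → (∀ I → sumOver I w ≡ sumOver J w → I ≡ J) → ∀ I → E I ≡ E J → I ≡ J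
  E-unique J w-unique I EI≡EJ = w-unique I (trans (sumOver-w I) (trans (cong (λ t → (+ t) ℚ./ L) EI≡EJ) (sym (sumOver-w J))))

  E-∁ : ∀ J → E (∁ J) ≡ Eₜₒₜ ℕ.∸ E J
  E-∁ J = sym (trans (cong (ℕ._∸ E J) (sym (subsetSumℕ-∁ J e))) (ℕP.m+n∸m≡n (E J) (E (∁ J))))

  frac-n₀*sumOver-w : ∀ I → frac ((+ n₀ ℚ./ 1) ℚ.* sumOver I w) ≡ (+ (E I % L′)) ℚ./ L′
  frac-n₀*sumOver-w I = trans (cong (λ q → frac ((+ n₀ ℚ./ 1) ℚ.* q)) (sumOver-w I))
                              (trans (cong frac (*-/-cancelˡ (E I) n₀ L′)) (frac-/ (E I) L′))

  frac-sum : ∀ J → E J % L′ ≤ Eₜₒₜ % L′ →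
             frac ((+ n₀ ℚ./ 1) ℚ.* sumOver J w) ℚ.+ frac ((+ n₀ ℚ./ 1) ℚ.* sumOver (∁ J) w) ≡ (+ (Eₜₒₜ % L′)) ℚ./ L′
  frac-sum J EJ%≤Eₜₒₜ% = begin
      frac ((+ n₀ ℚ./ 1) ℚ.* sumOver J w) ℚ.+ frac ((+ n₀ ℚ./ 1) ℚ.* sumOver (∁ J) w)
        ≡⟨ cong₂ ℚ._+_ (frac-n₀*sumOver-w J) (trans (frac-n₀*sumOver-w (∁ J)) (cong (λ t → (+ (t % L′)) ℚ./ L′) (E-∁ J))) ⟩
      (+ (E J % L′)) ℚ./ L′ ℚ.+ (+ ((Eₜₒₜ ℕ.∸ E J) % L′)) ℚ./ L′
        ≡⟨ /-+-distrib (E J % L′) ((Eₜₒₜ ℕ.∸ E J) % L′) L′ ⟩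
      (+ (E J % L′ ℕ.+ (Eₜₒₜ ℕ.∸ E J) % L′)) ℚ./ L′
        ≡⟨ cong (λ t → (+ t) ℚ./ L′) (%-+-∸ L′ (subsetSumℕ-≤-⊤ J e) EJ%≤Eₜₒₜ%) ⟩
      (+ (Eₜₒₜ % L′)) ℚ./ L′ ∎
    where open ≡-Reasoning

  floor≤sumOver-w : ∀ I → (Eₜₒₜ ℕ./ L) ℕ.* L ≤ E I → (floor (sumOver ⊤ w) ℚ./ 1) ℚ.≤ sumOver I w
  floor≤sumOver-w I mL≤EI = subst₂ ℚ._≤_ (cong (ℚ._/ 1) (sym floor-sumOver-w)) (sym (sumOver-w I)) (/1-≤-/ {Eₜₒₜ ℕ./ L} {E I} {L} mL≤EI)

corollary1p3 : (k : ℕ) → 1 ≤ k →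
  (a : Fin (suc k) → ℤ) → (n : Fin (suc k) → ℕ) → (npos : ∀ s → 0 < n s) →
  (ms : Fin k → ℕ) → (∀ i → 0 < ms i) →
  let w : Fin k → ℚ
      w i = ratio (ms i) (n (suc i)) (npos (suc i))
      m : ℤ
      m = floor (sumOver ⊤ w)
  in
  (∀ (x : ℤ) → m ℤ.< + coverCount a n x) →
  (J : Subset k) →
  (∀ (I : Subset k) → sumOver I w ≡ sumOver J w → I ≡ J) →
  (frac ((+ n zero ℚ./ 1) ℚ.* sumOver J w) ℚ.+ frac ((+ n zero ℚ./ 1) ℚ.* sumOver (∁ J) w) ℚ.< ℚ.1ℚ)
  × ((m ℚ./ 1) ℚ.≤ sumOver J w ⊎ (m ℚ./ 1) ℚ.≤ sumOver (∁ J) w)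
corollary1p3 k _ a n npos ms _ cover J w-unique =
    subst (ℚ._< ℚ.1ℚ) (sym (frac-sum J EJ%L′≤Eₜₒₜ%L′)) (/-<-1 (ℕDM.m%n<n Eₜₒₜ L′))
  , Sum.map (floor≤sumOver-w J) (floor≤sumOver-w (∁ J) ∘ subst (_ ≤_) (sym (E-∁ J))) mL≤EJ⊎mL≤Eₜₒₜ∸EJ
  where
  open IntegerForm k a n npos ms
  open Covered (Eₜₒₜ ℕ./ L) Eₜₒₜ<[1+m]L (cover-ℕ cover)
  open UniqueSum J (E-unique J w-unique)
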